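{- Let $p$ be a prime and $w\ge1$ an integer. Let $j_0\in\{0,\ldots,p-1\}$ with $j_0\equiv\frac12(w-1)p(p+1)\pmod p$, and $$\mathcal E_{j_0}=\Big\{(k_1,\ldots,k_p)\in\mathbb N^p:\ \sum_{i=1}^p k_i=pw-(p-1),\ \sum_{i=1}^p ik_i\equiv j_0\pmod p\Big\}.$$ For $\underline k\in\mathcal E_{j_0}$ set $c_{\underline k,0}=\frac1p\Big(\frac{(w-1)p(p+1)}2-\sum_{i=1}^p ik_i\Big)+1$ and, for $1\le j\le p-1$, $c_{\underline k,j}=c_{\underline k,0}+j(w-1)-\sum_{i=1}^j k_i$. Then $\{(c_{\underline k,0},\ldots,c_{\underline k,p-1}):\underline k\in\mathcal E_{j_0}\}$ is exactly the set of ancestors for $p$ and $w$, and it parametrizes the Scopes families (each Scopes family contains exactly one of these vectors).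
   Context: $\mathbb N=\{0,1,2,\ldots\}$. Fix a prime $p$ and $w\ge1$. Let $\mathscr C_p=\{(c_0,\ldots,c_{p-1})\in\mathbb Z^p:\sum c_j=0\}$. For $1\le j\le p-1$, $c\in\mathscr C_p$ is $j$-allowed if $c_j-c_{j-1}\ge w$, and then $\mathrm{sc}_j(c)$ is $c$ with the coordinates $c_{j-1}$ and $c_j$ interchanged. $c$ is $0$-allowed if $c_0-c_{p-1}>w$, and then $\mathrm{sc}_0(c)=(c_{p-1}+1,c_1,\ldots,c_{p-2},c_0-1)$. $c$ is allowed if it is $j$-allowed for some $j$, and an ancestor if it is not allowed. The Scopes families are the equivalence classes of the equivalence relation on $\mathscr C_p$ generated by $c\sim\mathrm{sc}_j(c)$ for all $j$ and all $j$-allowed $c$. -}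

module Defs where

open import Data.Nat as ℕ using (ℕ; zero; suc; NonZero; _<?_)
import Data.Nat.DivMod as ℕD
open import Data.Integer as ℤ using (ℤ; +_)
open import Data.Integer.DivMod using (_/ℕ_)
open import Data.Fin using (Fin; toℕ; fromℕ<)
open import Data.Product using (Σ; ∃; _×_; _,_)
open import Data.Sum using (_⊎_)
open import Relation.Nullary using (¬_; yes; no)
open import Relation.Binary.PropositionalEquality using (_≡_)
open import Data.Bool using (if_then_else_)
open import Relation.Nullary.Decidable using (⌊_⌋)

Vecℤ : ℕ → Set
Vecℤ p = Fin p → ℤ

-- coordinate access by a natural-number index (default value outside 0..p-1,
-- only ever used with indices in range)
get : {p : ℕ} → Vecℤ p → ℕ → ℤ
get {p} c i with i <? p
... | yes h = c (fromℕ< h)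
... | no _  = + 0

getℕ : {p : ℕ} → (Fin p → ℕ) → ℕ → ℕ
getℕ {p} k i with i <? p
... | yes h = k (fromℕ< h)
... | no _  = 0

Σℕ< : ℕ → (ℕ → ℕ) → ℕ
Σℕ< zero    f = 0
Σℕ< (suc n) f = Σℕ< n f ℕ.+ f n

Σℤ< : ℕ → (ℕ → ℤ) → ℤ
Σℤ< zero    f = + 0
Σℤ< (suc n) f = Σℤ< n f ℤ.+ f n

InCp : (p : ℕ) → Vecℤ p → Set
InCp p c = Σℤ< p (get c) ≡ + 0

AllowedJ : (p w : ℕ) → Vecℤ p → ℕ → Set
AllowedJ p w c j = + w ℤ.≤ get c j ℤ.- get c (j ℕ.∸ 1)

Allowed0 : (p w : ℕ) → Vecℤ p → Set
Allowed0 p w c = + w ℤ.< get c 0 ℤ.- get c (p ℕ.∸ 1)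

scJ : (p : ℕ) → Vecℤ p → ℕ → Vecℤ p
scJ p c j i =
  if ⌊ toℕ i ℕ.≟ j ⌋ then get c (j ℕ.∸ 1)
  else (if ⌊ toℕ i ℕ.≟ (j ℕ.∸ 1) ⌋ then get c j else c i)

sc0 : (p : ℕ) → Vecℤ p → Vecℤ p
sc0 p c i =
  if ⌊ toℕ i ℕ.≟ 0 ⌋ then get c (p ℕ.∸ 1) ℤ.+ + 1
  else (if ⌊ toℕ i ℕ.≟ (p ℕ.∸ 1) ⌋ then get c 0 ℤ.- + 1 else c i)

_≗ᵥ_ : {p : ℕ} → Vecℤ p → Vecℤ p → Set
c ≗ᵥ d = ∀ i → c i ≡ d i

Allowed : (p w : ℕ) → Vecℤ p → Set
Allowed p w c = (Σ ℕ λ j → (1 ℕ.≤ j) × (j ℕ.< p) × AllowedJ p w c j) ⊎ Allowed0 p w c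

Ancestor : (p w : ℕ) → Vecℤ p → Set
Ancestor p w c = ¬ Allowed p w c

data ScStep (p w : ℕ) (c : Vecℤ p) : Vecℤ p → Set where
  stepJ : ∀ {d} j → 1 ℕ.≤ j → j ℕ.< p → AllowedJ p w c j → d ≗ᵥ scJ p c j → ScStep p w c d
  step0 : ∀ {d} → Allowed0 p w c → d ≗ᵥ sc0 p c → ScStep p w c d

data ScopesEq (p w : ℕ) : Vecℤ p → Vecℤ p → Set where
  eq-refl  : ∀ {c d} → c ≗ᵥ d → ScopesEq p w c d
  eq-step  : ∀ {c d} → ScStep p w c d → ScopesEq p w c d
  eq-sym   : ∀ {c d} → ScopesEq p w c d → ScopesEq p w d c
  eq-trans : ∀ {c d e} → ScopesEq p w c d → ScopesEq p w d e → ScopesEq p w c e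

-- (w-1) p (p+1) / 2  (an integer since p(p+1) is even)
Xval : ℕ → ℕ → ℕ
Xval p w = ((w ℕ.∸ 1) ℕ.* p ℕ.* (p ℕ.+ 1)) ℕD./ 2

-- k = (k_1,...,k_p) stored as k : Fin p → ℕ with k_i at index i-1
-- Σ_{i=1}^p i k_i
wsum : (p : ℕ) → (Fin p → ℕ) → ℕ
wsum p k = Σℕ< p (λ i → suc i ℕ.* getℕ k i)

InE : (p w j0 : ℕ) → .{{NonZero p}} → (Fin p → ℕ) → Set
InE p w j0 k = (Σℕ< p (getℕ k) ≡ p ℕ.* w ℕ.∸ (p ℕ.∸ 1))
             × (wsum p k ℕD.% p ≡ j0 ℕD.% p)

ck0 : (p w : ℕ) → .{{NonZero p}} → (Fin p → ℕ) → ℤ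
ck0 p w k = ((+ Xval p w ℤ.- + wsum p k) /ℕ p) ℤ.+ + 1

ckj : (p w : ℕ) → .{{NonZero p}} → (Fin p → ℕ) → ℕ → ℤ
ckj p w k j = ck0 p w k ℤ.+ + (j ℕ.* (w ℕ.∸ 1)) ℤ.- + Σℕ< j (getℕ k)

ck : (p w : ℕ) → .{{NonZero p}} → (Fin p → ℕ) → Vecℤ p
ck p w k i = ckj p w k (toℕ i)

-- The moves sc_j form a terminating rewriting system on 𝒞_p: in the coordinates h_i = p c_i + i,
-- a move replaces two entries u > v + p w by v + 1 and u - 1, so Σ h_i² drops. Two moves applicable
-- to the same vector either commute or satisfy a braid relation (mutually inverse moves are never
-- both allowed), so the system is locally confluent, and by Newman's lemma every Scopes family
-- contains exactly one normal form, i.e. exactly one ancestor. With k_{j+1} = (w - 1) - (c_{j+1} - c_j)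
-- and k_p = w - (c_0 - c_{p-1}), a vector is an ancestor iff all k_i ≥ 0; it is then determined by
-- c_0 and k, Σ k_i = p w - (p - 1), and Σ c_j = 0 reads p (c_0 - 1) = X - Σ i k_i with
-- X = (w - 1) p (p + 1) / 2, which gives both the congruence defining ℰ_{j0} and the formula for
-- c_{k,0}.
module Submission where

open import Defs
open import Data.Nat using (ℕ; NonZero; _≤_; _<_)
open import Data.Nat.DivMod using (_%_)
open import Data.Nat.Primality using (Prime)
open import Data.Fin using (Fin)
open import Data.Product using (Σ; _×_)
open import Function.Bundles using (_⇔_; mk⇔; Equivalence)
open import Relation.Binary.PropositionalEquality using (_≡_)

open import Data.Bool using (if_then_else_)
open import Data.Fin using (toℕ; fromℕ<)
import Data.Fin.Properties as Finₚ
open import Data.Integer as ℤ using (ℤ; +_; -[1+_])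
open import Data.Integer.DivMod using (_/ℕ_; [n/ℕd]*d≤n; n<s[n/ℕd]*d)
import Data.Integer.Properties as ℤₚ
open import Data.Integer.Tactic.RingSolver using (solve-∀; solve)
open import Data.List using ([]; _∷_)
open import Data.Nat as ℕ using (zero; suc; z≤n; s≤s; _<?_)
open import Data.Nat.Induction using (<-wellFounded)
import Data.Nat.DivMod as ℕ
import Data.Nat.Properties as ℕₚ
import Data.Nat.Tactic.RingSolver as ℕ-Ring
open import Data.Product using (∃; ∃₂; _,_; proj₁; proj₂)
open import Data.Sum using (_⊎_; inj₁; inj₂; [_,_]′)
open import Data.Unit using (⊤; tt)
open import Function using (flip; _∘_)
open import Induction.WellFounded using (Acc; acc; module Subrelation)
open import Relation.Binary.Construct.Closure.ReflexiveTransitive using (Star; ε; _◅_; _◅◅_)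
import Relation.Binary.Construct.On as On
open import Relation.Binary.Structures using (IsEquivalence)
open import Relation.Binary.PropositionalEquality
  using (refl; sym; trans; cong; cong₂; subst; _≢_; module ≡-Reasoning)
open import Relation.Nullary using (¬_; Dec; yes; no; contradiction)
open import Relation.Nullary.Decidable using (⌊_⌋; toSum)

open ≡-Reasoning

i≤j⇒∃[n]j≡i+n : ∀ {i j} → i ℤ.≤ j → ∃ λ n → j ≡ i ℤ.+ + n
i≤j⇒∃[n]j≡i+n {i} {j} i≤j = ℤ.∣ j ℤ.- i ∣ , (begin
  j                         ≡⟨ solve (i ∷ j ∷ []) ⟩
  i ℤ.+ (j ℤ.- i)           ≡⟨ cong (λ z → i ℤ.+ z) (sym (ℤₚ.0≤i⇒+∣i∣≡i (ℤₚ.i≤j⇒0≤j-i i≤j))) ⟩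
  i ℤ.+ + ℤ.∣ j ℤ.- i ∣     ∎)

j≡i+n⇒i≤j : ∀ {i j} n → j ≡ i ℤ.+ + n → i ℤ.≤ j
j≡i+n⇒i≤j {i} n refl = ℤₚ.i≤i+j i (+ n)

i-j<i : ∀ i {j} → + 0 ℤ.< j → i ℤ.- j ℤ.< i
i-j<i i {j} 0<j = subst (i ℤ.- j ℤ.<_) (ℤₚ.+-identityʳ i) (ℤₚ.+-monoʳ-< i (ℤₚ.neg-mono-< 0<j))

m+n≡o⇒+m≡+o-+n : ∀ {a b c} → a ℕ.+ b ≡ c → + a ≡ + c ℤ.- + b
m+n≡o⇒+m≡+o-+n {a} {b} refl = trans (x≡x+y-y (+ a) (+ b)) (cong (ℤ._- + b) (sym (ℤₚ.pos-+ a b)))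
  where x≡x+y-y : ∀ x y → x ≡ x ℤ.+ y ℤ.- y
        x≡x+y-y = solve-∀

k≤j-i⇒∃[n]j≡i+[k+n] : ∀ {k i j} → + k ℤ.≤ j ℤ.- i → ∃ λ n → j ≡ i ℤ.+ + (k ℕ.+ n)
k≤j-i⇒∃[n]j≡i+[k+n] {k} {i} {j} k≤j-i with i≤j⇒∃[n]j≡i+n k≤j-i
... | n , j-i≡ = n , trans (y≡x+[y-x] i j) (cong (λ z → i ℤ.+ z) j-i≡)
  where y≡x+[y-x] : ∀ x y → y ≡ x ℤ.+ (y ℤ.- x)
        y≡x+[y-x] = solve-∀

k+1≰d⇒0≤k-d : ∀ {k d} → ¬ (+ suc k ℤ.≤ d) → + 0 ℤ.≤ + k ℤ.- d
k+1≰d⇒0≤k-d k+1≰d = ℤₚ.i≤j⇒0≤j-i (ℤₚ.i<j⇒i≤pred[j] (ℤₚ.≰⇒> k+1≰d))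

update : ℕ → ℤ → (ℕ → ℤ) → ℕ → ℤ
update a u f i = if ⌊ i ℕ.≟ a ⌋ then u else f i

update-≡ : ∀ a u f → update a u f a ≡ u
update-≡ a u f with a ℕ.≟ a
... | yes _   = refl
... | no a≢a  = contradiction refl a≢a

update-≢ : ∀ {a i} u f → i ≢ a → update a u f i ≡ f i
update-≢ {a} {i} u f i≢a with i ℕ.≟ a
... | yes i≡a = contradiction i≡a i≢a
... | no _    = refl

Σℤ<-cong : ∀ n {f g : ℕ → ℤ} → (∀ i → i < n → f i ≡ g i) → Σℤ< n f ≡ Σℤ< n g
Σℤ<-cong zero    f≗g = refl
Σℤ<-cong (suc n) f≗g = cong₂ ℤ._+_ (Σℤ<-cong n (λ i i<n → f≗g i (ℕₚ.m<n⇒m<1+n i<n))) (f≗g n ℕₚ.≤-refl)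

Σℤ<-update : ∀ n (F : ℕ → ℤ → ℤ) f {a} u → a < n →
  Σℤ< n (λ i → F i (update a u f i)) ≡ Σℤ< n (λ i → F i (f i)) ℤ.+ (F a u ℤ.- F a (f a))
Σℤ<-update (suc n) F f {a} u a<1+n with ℕₚ.m<1+n⇒m<n∨m≡n a<1+n
... | inj₂ refl = begin
  Σℤ< n (λ i → F i (update n u f i)) ℤ.+ F n (update n u f n)
    ≡⟨ cong₂ ℤ._+_ (Σℤ<-cong n (λ i i<n → cong (F i) (update-≢ u f (ℕₚ.<⇒≢ i<n))))
                   (cong (F n) (update-≡ n u f)) ⟩
  Σℤ< n (λ i → F i (f i)) ℤ.+ F n u
    ≡⟨ x+z≡x+y+[z-y] (Σℤ< n (λ i → F i (f i))) (F n (f n)) (F n u) ⟩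
  Σℤ< n (λ i → F i (f i)) ℤ.+ F n (f n) ℤ.+ (F n u ℤ.- F n (f n)) ∎
  where x+z≡x+y+[z-y] : ∀ x y z → x ℤ.+ z ≡ x ℤ.+ y ℤ.+ (z ℤ.- y)
        x+z≡x+y+[z-y] = solve-∀
... | inj₁ a<n = begin
  Σℤ< n (λ i → F i (update a u f i)) ℤ.+ F n (update a u f n)
    ≡⟨ cong₂ ℤ._+_ (Σℤ<-update n F f u a<n) (cong (F n) (update-≢ u f (ℕₚ.<⇒≢ a<n ∘ sym))) ⟩
  Σℤ< n (λ i → F i (f i)) ℤ.+ (F a u ℤ.- F a (f a)) ℤ.+ F n (f n)
    ≡⟨ x+z+y≡x+y+z (Σℤ< n (λ i → F i (f i))) (F a u ℤ.- F a (f a)) (F n (f n)) ⟩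
  Σℤ< n (λ i → F i (f i)) ℤ.+ F n (f n) ℤ.+ (F a u ℤ.- F a (f a)) ∎
  where x+z+y≡x+y+z : ∀ x z y → x ℤ.+ z ℤ.+ y ≡ x ℤ.+ y ℤ.+ z
        x+z+y≡x+y+z = solve-∀

Σℤ<-nonneg : ∀ n (f : ℕ → ℤ) → (∀ i → + 0 ℤ.≤ f i) → + 0 ℤ.≤ Σℤ< n f
Σℤ<-nonneg zero    f 0≤f = ℤₚ.≤-refl
Σℤ<-nonneg (suc n) f 0≤f = ℤₚ.+-mono-≤ (Σℤ<-nonneg n f 0≤f) (0≤f n)

Σℕ<-cast : ∀ n (f : ℕ → ℕ) → + Σℕ< n f ≡ Σℤ< n (λ i → + f i)
Σℕ<-cast zero    f = refl
Σℕ<-cast (suc n) f = trans (ℤₚ.pos-+ (Σℕ< n f) (f n)) (cong (ℤ._+ + f n) (Σℕ<-cast n f))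

Σℤ<-affine : ∀ n (c : ℤ) (f g : ℕ → ℤ) →
  Σℤ< n (λ j → c ℤ.+ f j ℤ.- g j) ≡ + n ℤ.* c ℤ.+ Σℤ< n f ℤ.- Σℤ< n g
Σℤ<-affine zero    c f g = solve (c ∷ [])
Σℤ<-affine (suc n) c f g = begin
  Σℤ< n (λ j → c ℤ.+ f j ℤ.- g j) ℤ.+ (c ℤ.+ f n ℤ.- g n)
    ≡⟨ cong (ℤ._+ (c ℤ.+ f n ℤ.- g n)) (Σℤ<-affine n c f g) ⟩
  + n ℤ.* c ℤ.+ Σℤ< n f ℤ.- Σℤ< n g ℤ.+ (c ℤ.+ f n ℤ.- g n)
    ≡⟨ regroup (+ n) c (Σℤ< n f) (Σℤ< n g) (f n) (g n) ⟩
  (+ 1 ℤ.+ + n) ℤ.* c ℤ.+ (Σℤ< n f ℤ.+ f n) ℤ.- (Σℤ< n g ℤ.+ g n) ∎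
  where regroup : ∀ m c F G x y →
          m ℤ.* c ℤ.+ F ℤ.- G ℤ.+ (c ℤ.+ x ℤ.- y) ≡ (+ 1 ℤ.+ m) ℤ.* c ℤ.+ (F ℤ.+ x) ℤ.- (G ℤ.+ y)
        regroup = solve-∀

Σℕ<-summation-by-parts : ∀ n (f : ℕ → ℕ) →
  Σℕ< n (λ j → Σℕ< j f) ℕ.+ Σℕ< n (λ i → suc i ℕ.* f i) ≡ n ℕ.* Σℕ< n f
Σℕ<-summation-by-parts zero    f = refl
Σℕ<-summation-by-parts (suc n) f = begin
  (P ℕ.+ Σℕ< n f) ℕ.+ (W ℕ.+ suc n ℕ.* f n) ≡⟨ regroup P W (Σℕ< n f) (f n) n ⟩
  (P ℕ.+ W) ℕ.+ Σℕ< n f ℕ.+ suc n ℕ.* f n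
    ≡⟨ cong (λ z → z ℕ.+ Σℕ< n f ℕ.+ suc n ℕ.* f n) (Σℕ<-summation-by-parts n f) ⟩
  n ℕ.* Σℕ< n f ℕ.+ Σℕ< n f ℕ.+ suc n ℕ.* f n ≡⟨ factor n (Σℕ< n f) (f n) ⟩
  suc n ℕ.* (Σℕ< n f ℕ.+ f n)                ∎
  where
  P = Σℕ< n (λ j → Σℕ< j f)
  W = Σℕ< n (λ i → suc i ℕ.* f i)
  regroup : ∀ P W S x n → P ℕ.+ S ℕ.+ (W ℕ.+ suc n ℕ.* x) ≡ P ℕ.+ W ℕ.+ S ℕ.+ suc n ℕ.* x
  regroup = ℕ-Ring.solve-∀
  factor : ∀ n S x → n ℕ.* S ℕ.+ S ℕ.+ suc n ℕ.* x ≡ suc n ℕ.* (S ℕ.+ x)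
  factor = ℕ-Ring.solve-∀

2*Σℕ<id+n≡n*n : ∀ n → 2 ℕ.* Σℕ< n (λ j → j) ℕ.+ n ≡ n ℕ.* n
2*Σℕ<id+n≡n*n zero    = refl
2*Σℕ<id+n≡n*n (suc n) = begin
  2 ℕ.* (T ℕ.+ n) ℕ.+ suc n       ≡⟨ regroup T n ⟩
  (2 ℕ.* T ℕ.+ n) ℕ.+ 2 ℕ.* n ℕ.+ 1 ≡⟨ cong (λ z → z ℕ.+ 2 ℕ.* n ℕ.+ 1) (2*Σℕ<id+n≡n*n n) ⟩
  n ℕ.* n ℕ.+ 2 ℕ.* n ℕ.+ 1         ≡⟨ square n ⟩
  suc n ℕ.* suc n                   ∎
  where
  T = Σℕ< n (λ j → j)
  regroup : ∀ T n → 2 ℕ.* (T ℕ.+ n) ℕ.+ suc n ≡ (2 ℕ.* T ℕ.+ n) ℕ.+ 2 ℕ.* n ℕ.+ 1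
  regroup = ℕ-Ring.solve-∀
  square : ∀ n → n ℕ.* n ℕ.+ 2 ℕ.* n ℕ.+ 1 ≡ suc n ℕ.* suc n
  square = ℕ-Ring.solve-∀

Σℕ<-distribʳ-* : ∀ n (f : ℕ → ℕ) c → Σℕ< n (λ j → f j ℕ.* c) ≡ Σℕ< n f ℕ.* c
Σℕ<-distribʳ-* zero    f c = refl
Σℕ<-distribʳ-* (suc n) f c =
  trans (cong (ℕ._+ f n ℕ.* c) (Σℕ<-distribʳ-* n f c)) (sym (ℕₚ.*-distribʳ-+ c (Σℕ< n f) (f n)))

[i*n]/ℕn≡i : ∀ i n .{{_ : ℕ.NonZero n}} → (i ℤ.* + n) /ℕ n ≡ i
[i*n]/ℕn≡i i n@(suc _) = ℤₚ.≤-antisym q≤i i≤q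
  where
  q = (i ℤ.* + n) /ℕ n
  q≤i : q ℤ.≤ i
  q≤i = ℤₚ.*-cancelʳ-≤-pos q i (+ n) ([n/ℕd]*d≤n (i ℤ.* + n) n)
  i≤q : i ℤ.≤ q
  i≤q = subst (i ℤ.≤_) (ℤₚ.pred-suc q)
          (ℤₚ.i<j⇒i≤pred[j] (ℤₚ.*-cancelʳ-<-nonNeg {i} {ℤ.suc q} (+ n) (n<s[n/ℕd]*d (i ℤ.* + n) n)))

m%d≡n%d⇒m-n≡[m/d-n/d]*d : ∀ m n d .{{_ : ℕ.NonZero d}} → m ℕ.% d ≡ n ℕ.% d →
  + m ℤ.- + n ≡ (+ (m ℕ./ d) ℤ.- + (n ℕ./ d)) ℤ.* + d
m%d≡n%d⇒m-n≡[m/d-n/d]*d m n d m%d≡n%d = begin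
  + m ℤ.- + n
    ≡⟨ cong₂ (λ x y → + x ℤ.- + y) (ℕ.m≡m%n+[m/n]*n m d) (ℕ.m≡m%n+[m/n]*n n d) ⟩
  + (m ℕ.% d ℕ.+ m ℕ./ d ℕ.* d) ℤ.- + (n ℕ.% d ℕ.+ n ℕ./ d ℕ.* d)
    ≡⟨ cong₂ ℤ._-_ (+-cast (m ℕ.% d) (m ℕ./ d) d) (+-cast (n ℕ.% d) (n ℕ./ d) d) ⟩
  + (m ℕ.% d) ℤ.+ + (m ℕ./ d) ℤ.* + d ℤ.- (+ (n ℕ.% d) ℤ.+ + (n ℕ./ d) ℤ.* + d)
    ≡⟨ cong (λ r → + (m ℕ.% d) ℤ.+ + (m ℕ./ d) ℤ.* + d ℤ.- (+ r ℤ.+ + (n ℕ./ d) ℤ.* + d)) (sym m%d≡n%d) ⟩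
  + (m ℕ.% d) ℤ.+ + (m ℕ./ d) ℤ.* + d ℤ.- (+ (m ℕ.% d) ℤ.+ + (n ℕ./ d) ℤ.* + d)
    ≡⟨ cancel (+ (m ℕ.% d)) (+ (m ℕ./ d)) (+ (n ℕ./ d)) (+ d) ⟩
  (+ (m ℕ./ d) ℤ.- + (n ℕ./ d)) ℤ.* + d ∎
  where
  +-cast : ∀ r q d → + (r ℕ.+ q ℕ.* d) ≡ + r ℤ.+ + q ℤ.* + d
  +-cast r q d = trans (ℤₚ.pos-+ r (q ℕ.* d)) (cong (λ z → + r ℤ.+ z) (ℤₚ.pos-* q d))
  cancel : ∀ r a b d → r ℤ.+ a ℤ.* d ℤ.- (r ℤ.+ b ℤ.* d) ≡ (a ℤ.- b) ℤ.* d
  cancel = solve-∀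

m-n≡q*d⇒m%d≡n%d : ∀ m n d .{{_ : ℕ.NonZero d}} q → + m ℤ.- + n ≡ q ℤ.* + d → m ℕ.% d ≡ n ℕ.% d
m-n≡q*d⇒m%d≡n%d m n d (+ k) m-n≡kd = trans (cong (ℕ._% d) m≡n+kd) (ℕ.[m+kn]%n≡m%n n k d)
  where
  m≡n+kd : m ≡ n ℕ.+ k ℕ.* d
  m≡n+kd = ℤₚ.+-injective (begin
    + m                      ≡⟨ x≡y+[x-y] (+ m) (+ n) ⟩
    + n ℤ.+ (+ m ℤ.- + n)    ≡⟨ cong (λ z → + n ℤ.+ z) m-n≡kd ⟩
    + n ℤ.+ + k ℤ.* + d      ≡⟨ cong (λ z → + n ℤ.+ z) (sym (ℤₚ.pos-* k d)) ⟩
    + n ℤ.+ + (k ℕ.* d)      ≡⟨ sym (ℤₚ.pos-+ n (k ℕ.* d)) ⟩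
    + (n ℕ.+ k ℕ.* d)        ∎)
    where x≡y+[x-y] : ∀ x y → x ≡ y ℤ.+ (x ℤ.- y)
          x≡y+[x-y] = solve-∀
m-n≡q*d⇒m%d≡n%d m n d -[1+ k ] m-n≡-kd = sym (m-n≡q*d⇒m%d≡n%d n m d (+ suc k) (begin
  + n ℤ.- + m                    ≡⟨ y-x≡-[x-y] (+ m) (+ n) ⟩
  ℤ.- (+ m ℤ.- + n)              ≡⟨ cong ℤ.-_ m-n≡-kd ⟩
  ℤ.- (-[1+ k ] ℤ.* + d)         ≡⟨ ℤₚ.neg-distribˡ-* -[1+ k ] (+ d) ⟩
  + suc k ℤ.* + d                ∎))
  where y-x≡-[x-y] : ∀ x y → y ℤ.- x ≡ ℤ.- (x ℤ.- y)
        y-x≡-[x-y] = solve-∀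

module Newman {A : Set} {_≈_ : A → A → Set} (≈-isEquivalence : IsEquivalence _≈_) (_⟶_ : A → A → Set) where
  open IsEquivalence ≈-isEquivalence renaming (refl to ≈-refl; sym to ≈-sym; trans to ≈-trans)

  _⟶*_ : A → A → Set
  _⟶*_ = Star _⟶_

  Normal : A → Set
  Normal x = ∀ {y} → ¬ x ⟶ y

  _⇓_ : A → A → Set
  x ⇓ n = ∃ λ e → x ⟶* e × Normal e × e ≈ n

  Joinable : A → A → Set
  Joinable y z = ∃₂ λ e e′ → y ⟶* e × z ⟶* e′ × e ≈ e′

  Normal⇒⇓ : ∀ {x} → Normal x → x ⇓ x
  Normal⇒⇓ {x} nx = x , ε , nx , ≈-refl

  ⟶*-⇓ : ∀ {x y n} → x ⟶* y → y ⇓ n → x ⇓ n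
  ⟶*-⇓ x⟶*y (e , y⟶*e , ne , e≈n) = e , x⟶*y ◅◅ y⟶*e , ne , e≈n

  Joinable-sym : ∀ {y z} → Joinable y z → Joinable z y
  Joinable-sym (e , e′ , y⟶*e , z⟶*e′ , e≈e′) = e′ , e , z⟶*e′ , y⟶*e , ≈-sym e≈e′

  module _ (⟶-respˡ : ∀ {x x′ y} → x ≈ x′ → x ⟶ y → x′ ⟶ y) where

    Normal-resp : ∀ {x x′} → x ≈ x′ → Normal x → Normal x′
    Normal-resp x≈x′ nx x′⟶y = nx (⟶-respˡ (≈-sym x≈x′) x′⟶y)

    ⇓-respˡ : ∀ {x x′ n} → x ≈ x′ → x ⇓ n → x′ ⇓ n
    ⇓-respˡ x≈x′ (_ , ε , nx , x≈n)         = _ , ε , Normal-resp x≈x′ nx , ≈-trans (≈-sym x≈x′) x≈n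
    ⇓-respˡ x≈x′ (e , x⟶y ◅ y⟶*e , ne , e≈n) = e , ⟶-respˡ x≈x′ x⟶y ◅ y⟶*e , ne , e≈n

    Joinable-respˡ : ∀ {y y′ z} → y ≈ y′ → Joinable y z → Joinable y′ z
    Joinable-respˡ y≈y′ (_ , e′ , ε , z⟶*e′ , y≈e′) =
      _ , e′ , ε , z⟶*e′ , ≈-trans (≈-sym y≈y′) y≈e′
    Joinable-respˡ y≈y′ (e , e′ , y⟶u ◅ u⟶*e , z⟶*e′ , e≈e′) =
      e , e′ , ⟶-respˡ y≈y′ y⟶u ◅ u⟶*e , z⟶*e′ , e≈e′

    Joinable-resp : ∀ {y y′ z z′} → y ≈ y′ → z ≈ z′ → Joinable y z → Joinable y′ z′
    Joinable-resp y≈y′ z≈z′ = Joinable-sym ∘ Joinable-respˡ z≈z′ ∘ Joinable-sym ∘ Joinable-respˡ y≈y′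

    module _ (μ : A → ℕ) (μ-decreasing : ∀ {x y} → x ⟶ y → μ y < μ x)
             (progress : ∀ x → ∃ (x ⟶_) ⊎ Normal x)
             (locally-confluent : ∀ {x y z} → x ⟶ y → x ⟶ z → Joinable y z) where

      private
        accessible : ∀ x → Acc (flip _⟶_) x
        accessible = Subrelation.wellFounded μ-decreasing (On.wellFounded μ <-wellFounded)

        normalise-acc : ∀ x → Acc (flip _⟶_) x → ∃ (x ⇓_)
        normalise-acc x (acc rs) with progress x
        ... | inj₂ nx        = x , Normal⇒⇓ nx
        ... | inj₁ (y , x⟶y) with normalise-acc y (rs x⟶y)
        ...   | n , y⇓n = n , ⟶*-⇓ (x⟶y ◅ ε) y⇓n

      -- abstract: letting the type checker unfold the well-founded recursion (e.g. when a normal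
      -- form is abstracted by 'with') makes checking blow up.
      abstract
        normalise : ∀ x → ∃ (x ⇓_)
        normalise x = normalise-acc x (accessible x)

      private
        ⇓-unique-acc : ∀ {x n n′} → Acc (flip _⟶_) x → x ⇓ n → x ⇓ n′ → n ≈ n′
        ⇓-unique-acc _ (_ , ε , _ , x≈n) (_ , ε , _ , x≈n′) = ≈-trans (≈-sym x≈n) x≈n′
        ⇓-unique-acc _ (_ , ε , nx , _) (_ , x⟶y ◅ _ , _)   = contradiction x⟶y nx
        ⇓-unique-acc _ (_ , x⟶y ◅ _ , _) (_ , ε , nx , _)   = contradiction x⟶y nx
        ⇓-unique-acc (acc rs) (e₁ , x⟶y₁ ◅ y₁⟶*e₁ , ne₁ , e₁≈n)
                              (e₂ , x⟶y₂ ◅ y₂⟶*e₂ , ne₂ , e₂≈n′) with locally-confluent x⟶y₁ x⟶y₂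
        ... | e , e′ , y₁⟶*e , y₂⟶*e′ , e≈e′ with normalise e
        ...   | m , e⇓m =
          ≈-trans (⇓-unique-acc (rs x⟶y₁) (e₁ , y₁⟶*e₁ , ne₁ , e₁≈n) (⟶*-⇓ y₁⟶*e e⇓m))
                  (≈-sym (⇓-unique-acc (rs x⟶y₂) (e₂ , y₂⟶*e₂ , ne₂ , e₂≈n′)
                                                  (⟶*-⇓ y₂⟶*e′ (⇓-respˡ e≈e′ e⇓m))))

      abstract
        ⇓-unique : ∀ {x n n′} → x ⇓ n → x ⇓ n′ → n ≈ n′
        ⇓-unique {x} = ⇓-unique-acc (accessible x)

get-lookup : ∀ {p} (c : Vecℤ p) {i} (i<p : i < p) → get c i ≡ c (fromℕ< i<p)
get-lookup {p} c {i} i<p with i <? p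
... | yes _   = refl
... | no i≮p = contradiction i<p i≮p

get-toℕ : ∀ {p} (c : Vecℤ p) i → get c (toℕ i) ≡ c i
get-toℕ c i = trans (get-lookup c (Finₚ.toℕ<n i)) (cong c (Finₚ.fromℕ<-toℕ i (Finₚ.toℕ<n i)))

getℕ-lookup : ∀ {p} (k : Fin p → ℕ) {i} (i<p : i < p) → getℕ k i ≡ k (fromℕ< i<p)
getℕ-lookup {p} k {i} i<p with i <? p
... | yes _   = refl
... | no i≮p = contradiction i<p i≮p

get-tabulate : ∀ {p} (c : Vecℤ p) (f : ℕ → ℤ) → (∀ i → c i ≡ f (toℕ i)) → ∀ j → j < p → get c j ≡ f j
get-tabulate c f c≗f _ j<p = trans (get-lookup c j<p) (trans (c≗f _) (cong f (Finₚ.toℕ-fromℕ< j<p)))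

square : ℤ → ℤ
square x = x ℤ.* x

0≤square : ∀ x → + 0 ℤ.≤ square x
0≤square (+ zero)  = ℤₚ.≤-refl
0≤square (+ suc n) = ℤ.+≤+ z≤n
0≤square -[1+ n ]  = ℤ.+≤+ z≤n

0≤i<j⇒∣i∣<∣j∣ : ∀ {i j} → + 0 ℤ.≤ i → i ℤ.< j → ℤ.∣ i ∣ < ℤ.∣ j ∣
0≤i<j⇒∣i∣<∣j∣ (ℤ.+≤+ _) (ℤ.+<+ m<n) = m<n

-- From the gaps s - x and y - s of two overlapping moves, the gaps met along both sides of the braid relation.
braid-gaps : ∀ {a b w} x s y → + (a ℕ.+ w) ℤ.≤ s ℤ.- x → + (b ℕ.+ w) ℤ.≤ y ℤ.- s →
  + (b ℕ.+ w) ℤ.≤ y ℤ.- (x ℤ.+ + a) × + (a ℕ.+ w) ℤ.≤ (y ℤ.- + b) ℤ.- (s ℤ.- + a) ×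
  + (a ℕ.+ w) ℤ.≤ (y ℤ.- + b) ℤ.- x × + (b ℕ.+ w) ℤ.≤ (s ℤ.+ + b) ℤ.- (x ℤ.+ + a)
braid-gaps {a} {b} {w} x s y s-x≥ y-s≥
  with k≤j-i⇒∃[n]j≡i+[k+n] {i = x} {s} s-x≥ | k≤j-i⇒∃[n]j≡i+[k+n] {i = s} {y} y-s≥
... | n₁ , refl | n₂ , refl =
  j≡i+n⇒i≤j (w ℕ.+ n₁ ℕ.+ n₂) (gap₁ x (+ a) (+ b) (+ w) (+ n₁) (+ n₂)) ,
  j≡i+n⇒i≤j n₂ (gap₂ x (+ a) (+ b) (+ w) (+ n₁) (+ n₂)) ,
  j≡i+n⇒i≤j (w ℕ.+ n₁ ℕ.+ n₂) (gap₃ x (+ a) (+ b) (+ w) (+ n₁) (+ n₂)) ,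
  j≡i+n⇒i≤j n₁ (gap₄ x (+ a) (+ b) (+ w) (+ n₁))
  where
  gap₁ : ∀ x A B W N₁ N₂ → x ℤ.+ (A ℤ.+ W ℤ.+ N₁) ℤ.+ (B ℤ.+ W ℤ.+ N₂) ℤ.- (x ℤ.+ A)
                           ≡ B ℤ.+ W ℤ.+ (W ℤ.+ N₁ ℤ.+ N₂)
  gap₁ = solve-∀
  gap₂ : ∀ x A B W N₁ N₂ → x ℤ.+ (A ℤ.+ W ℤ.+ N₁) ℤ.+ (B ℤ.+ W ℤ.+ N₂) ℤ.- B
                             ℤ.- (x ℤ.+ (A ℤ.+ W ℤ.+ N₁) ℤ.- A)
                           ≡ A ℤ.+ W ℤ.+ N₂
  gap₂ = solve-∀
  gap₃ : ∀ x A B W N₁ N₂ → x ℤ.+ (A ℤ.+ W ℤ.+ N₁) ℤ.+ (B ℤ.+ W ℤ.+ N₂) ℤ.- B ℤ.- x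
                           ≡ A ℤ.+ W ℤ.+ (W ℤ.+ N₁ ℤ.+ N₂)
  gap₃ = solve-∀
  gap₄ : ∀ x A B W N₁ → x ℤ.+ (A ℤ.+ W ℤ.+ N₁) ℤ.+ B ℤ.- (x ℤ.+ A) ≡ B ℤ.+ W ℤ.+ N₁
  gap₄ = solve-∀

opposite-gaps : ∀ {a b w} x y → + (a ℕ.+ suc w) ℤ.≤ y ℤ.- x → ¬ (+ (b ℕ.+ suc w) ℤ.≤ x ℤ.- y)
opposite-gaps {a} {b} {w} x y y-x≥ x-y≥ with k≤j-i⇒∃[n]j≡i+[k+n] {i = x} {y} y-x≥
... | n , refl = contradiction (ℕₚ.m+n≤o⇒n≤o b (ℤₚ.drop‿+≤+ b+w≤0)) λ ()
  where
  b+w≤0 : + (b ℕ.+ suc w) ℤ.≤ + 0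
  b+w≤0 = ℤₚ.≤-trans x-y≥
            (subst (ℤ._≤ + 0) (sym (x-[x+k]≡-k x (+ (a ℕ.+ suc w ℕ.+ n)))) (ℤₚ.neg-mono-≤ (ℤ.+≤+ z≤n)))
    where x-[x+k]≡-k : ∀ x k → x ℤ.- (x ℤ.+ k) ≡ ℤ.- k
          x-[x+k]≡-k = solve-∀

module Moves (p′ w′ : ℕ) (1≤p′ : 1 ≤ p′) where

  p w : ℕ
  p = suc p′
  w = suc w′

  -- inner a is sc_{a+1} and wrap is sc_0: a move exchanges the entries at its lower and upper
  -- position, shifting them by t (which is 1 only for sc_0).
  data Move : Set where
    inner : ℕ → Move
    wrap  : Move

  upper lower shift : Move → ℕ
  upper (inner a) = suc a
  upper wrap      = 0
  lower (inner a) = a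
  lower wrap      = p′
  shift (inner _) = 0
  shift wrap      = 1

  t : Move → ℤ
  t m = + shift m

  Valid : Move → Set
  Valid (inner a) = suc a < p
  Valid wrap      = ⊤

  upper<p : ∀ m → Valid m → upper m < p
  upper<p (inner a) v = v
  upper<p wrap      _ = s≤s z≤n

  lower<p : ∀ m → Valid m → lower m < p
  lower<p (inner a) v = ℕₚ.<-trans (ℕₚ.n<1+n a) v
  lower<p wrap      _ = ℕₚ.n<1+n p′

  lower≢upper : ∀ m → lower m ≢ upper m
  lower≢upper (inner a) = ℕₚ.<⇒≢ (ℕₚ.n<1+n a)
  lower≢upper wrap      = ℕₚ.<⇒≢ 1≤p′ ∘ sym

  Enabled : Move → (ℕ → ℤ) → Set
  Enabled m g = + (shift m ℕ.+ w) ℤ.≤ g (upper m) ℤ.- g (lower m)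

  move : Move → (ℕ → ℤ) → ℕ → ℤ
  move m g = update (upper m) (g (lower m) ℤ.+ t m) (update (lower m) (g (upper m) ℤ.- t m) g)

  move-at-upper : ∀ m g {i} → upper m ≡ i → move m g i ≡ g (lower m) ℤ.+ t m
  move-at-upper m g refl =
    update-≡ (upper m) (g (lower m) ℤ.+ t m) (update (lower m) (g (upper m) ℤ.- t m) g)

  move-at-lower : ∀ m g {i} → lower m ≡ i → move m g i ≡ g (upper m) ℤ.- t m
  move-at-lower m g refl =
    trans (update-≢ (g (lower m) ℤ.+ t m) (update (lower m) (g (upper m) ℤ.- t m) g) (lower≢upper m))
          (update-≡ (lower m) (g (upper m) ℤ.- t m) g)

  move-elsewhere : ∀ m g {i} → i ≢ upper m → i ≢ lower m → move m g i ≡ g i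
  move-elsewhere m g i≢u i≢l =
    trans (update-≢ (g (lower m) ℤ.+ t m) (update (lower m) (g (upper m) ℤ.- t m) g) i≢u)
          (update-≢ (g (upper m) ℤ.- t m) g i≢l)

  -- Vectors are handled through get, as functions ℕ → ℤ that matter only below p.
  _≈_ : (ℕ → ℤ) → (ℕ → ℤ) → Set
  f ≈ g = ∀ i → i < p → f i ≡ g i

  ≈-isEquivalence : IsEquivalence _≈_
  ≈-isEquivalence = record
    { refl  = λ _ _ → refl
    ; sym   = λ f≈g i i<p → sym (f≈g i i<p)
    ; trans = λ f≈g g≈h i i<p → trans (f≈g i i<p) (g≈h i i<p)
    }

  open IsEquivalence ≈-isEquivalence public using () renaming (refl to ≈-refl; sym to ≈-sym; trans to ≈-trans)

  move-resp : ∀ m {f g} → Valid m → f ≈ g → move m f ≈ move m g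
  move-resp m v f≈g i i<p =
    cong₂ (λ u z → if ⌊ i ℕ.≟ upper m ⌋ then u else z) (cong (ℤ._+ t m) (f≈g _ (lower<p m v)))
      (cong₂ (λ u z → if ⌊ i ℕ.≟ lower m ⌋ then u else z) (cong (ℤ._- t m) (f≈g _ (upper<p m v))) (f≈g i i<p))

  Enabled-resp : ∀ m {f g} → Valid m → f ≈ g → Enabled m f → Enabled m g
  Enabled-resp m v f≈g = subst (+ (shift m ℕ.+ w) ℤ.≤_) (cong₂ ℤ._-_ (f≈g _ (upper<p m v)) (f≈g _ (lower<p m v)))

  _⟶_ : (ℕ → ℤ) → (ℕ → ℤ) → Set
  g ⟶ h = ∃ λ m → Valid m × Enabled m g × h ≈ move m g

  ⟶-respˡ : ∀ {f g h} → f ≈ g → f ⟶ h → g ⟶ h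
  ⟶-respˡ f≈g (m , v , en , h≈) = m , v , Enabled-resp m v f≈g en , ≈-trans h≈ (move-resp m v f≈g)

  open Newman ≈-isEquivalence _⟶_ public

  height : ℕ → ℤ → ℤ
  height i y = + p ℤ.* y ℤ.+ + i

  height-upper : ∀ m x → height (upper m) (x ℤ.+ t m) ≡ height (lower m) x ℤ.+ + 1
  height-upper (inner a) x = polynomial (+ p) x (+ a)
    where polynomial : ∀ P x a → P ℤ.* (x ℤ.+ + 0) ℤ.+ (+ 1 ℤ.+ a) ≡ P ℤ.* x ℤ.+ a ℤ.+ + 1
          polynomial = solve-∀
  height-upper wrap      x = polynomial (+ p′) x
    where polynomial : ∀ P′ x → (+ 1 ℤ.+ P′) ℤ.* (x ℤ.+ + 1) ℤ.+ + 0 ≡ (+ 1 ℤ.+ P′) ℤ.* x ℤ.+ P′ ℤ.+ + 1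
          polynomial = solve-∀

  height-lower : ∀ m y → height (lower m) (y ℤ.- t m) ≡ height (upper m) y ℤ.- + 1
  height-lower (inner a) y = polynomial (+ p) y (+ a)
    where polynomial : ∀ P y a → P ℤ.* (y ℤ.- + 0) ℤ.+ a ≡ P ℤ.* y ℤ.+ (+ 1 ℤ.+ a) ℤ.- + 1
          polynomial = solve-∀
  height-lower wrap      y = polynomial (+ p′) y
    where polynomial : ∀ P′ y → (+ 1 ℤ.+ P′) ℤ.* (y ℤ.- + 1) ℤ.+ P′ ≡ (+ 1 ℤ.+ P′) ℤ.* y ℤ.+ + 0 ℤ.- + 1
          polynomial = solve-∀

  height-gap : ∀ m x y → height (upper m) y ℤ.- height (lower m) x ℤ.- + 1 ≡ + p ℤ.* (y ℤ.- x ℤ.- t m)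
  height-gap (inner a) x y = polynomial (+ p) x y (+ a)
    where polynomial : ∀ P x y a → P ℤ.* y ℤ.+ (+ 1 ℤ.+ a) ℤ.- (P ℤ.* x ℤ.+ a) ℤ.- + 1 ≡ P ℤ.* (y ℤ.- x ℤ.- + 0)
          polynomial = solve-∀
  height-gap wrap      x y = polynomial (+ p′) x y
    where polynomial : ∀ P′ x y → (+ 1 ℤ.+ P′) ℤ.* y ℤ.+ + 0 ℤ.- ((+ 1 ℤ.+ P′) ℤ.* x ℤ.+ P′) ℤ.- + 1
                             ≡ (+ 1 ℤ.+ P′) ℤ.* (y ℤ.- x ℤ.- + 1)
          polynomial = solve-∀

  energy : (ℕ → ℤ) → ℤ
  energy g = Σℤ< p (λ i → square (height i (g i)))

  Σ-move-map : ∀ (F : ℕ → ℤ → ℤ) m g → Valid m →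
    Σℤ< p (λ i → F i (move m g i)) ≡ Σℤ< p (λ i → F i (g i))
      ℤ.+ (F (lower m) (g (upper m) ℤ.- t m) ℤ.- F (lower m) (g (lower m)))
      ℤ.+ (F (upper m) (g (lower m) ℤ.+ t m) ℤ.- F (upper m) (g (upper m)))
  Σ-move-map F m g v = begin
    Σℤ< p (λ i → F i (move m g i))
      ≡⟨ Σℤ<-update p F g′ (x ℤ.+ t m) (upper<p m v) ⟩
    Σℤ< p (λ i → F i (g′ i)) ℤ.+ (F U (x ℤ.+ t m) ℤ.- F U (g′ U))
      ≡⟨ cong₂ (λ e z → e ℤ.+ (F U (x ℤ.+ t m) ℤ.- F U z))
               (Σℤ<-update p F g (y ℤ.- t m) (lower<p m v)) (update-≢ (y ℤ.- t m) g (lower≢upper m ∘ sym)) ⟩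
    Σℤ< p (λ i → F i (g i)) ℤ.+ (F L (y ℤ.- t m) ℤ.- F L x) ℤ.+ (F U (x ℤ.+ t m) ℤ.- F U y) ∎
    where
    U = upper m
    L = lower m
    x = g L
    y = g U
    g′ = update L (y ℤ.- t m) g

  Σ-move : ∀ m g → Valid m → Σℤ< p (move m g) ≡ Σℤ< p g
  Σ-move m g v = trans (Σ-move-map (λ _ z → z) m g v) (cancel (Σℤ< p g) (g (lower m)) (g (upper m)) (t m))
    where cancel : ∀ S x y t → S ℤ.+ (y ℤ.- t ℤ.- x) ℤ.+ (x ℤ.+ t ℤ.- y) ≡ S
          cancel = solve-∀

  energy-move : ∀ m g → Valid m →
    energy (move m g) ≡ energy g ℤ.- + 2 ℤ.* (+ p ℤ.* (g (upper m) ℤ.- g (lower m) ℤ.- t m))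
  energy-move m g v = begin
    energy (move m g)
      ≡⟨ Σ-move-map (λ i z → square (height i z)) m g v ⟩
    energy g ℤ.+ (square (height L (y ℤ.- t m)) ℤ.- square hl) ℤ.+ (square (height U (x ℤ.+ t m)) ℤ.- square hu)
      ≡⟨ cong₂ (λ a b → energy g ℤ.+ (square a ℤ.- square hl) ℤ.+ (square b ℤ.- square hu))
               (height-lower m y) (height-upper m x) ⟩
    energy g ℤ.+ (square (hu ℤ.- + 1) ℤ.- square hl) ℤ.+ (square (hl ℤ.+ + 1) ℤ.- square hu)
      ≡⟨ swap-squares (energy g) hu hl ⟩
    energy g ℤ.- + 2 ℤ.* (hu ℤ.- hl ℤ.- + 1)
      ≡⟨ cong (λ z → energy g ℤ.- + 2 ℤ.* z) (height-gap m x y) ⟩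
    energy g ℤ.- + 2 ℤ.* (+ p ℤ.* (y ℤ.- x ℤ.- t m)) ∎
    where
    U = upper m
    L = lower m
    x = g L
    y = g U
    hu = height U y
    hl = height L x
    swap-squares : ∀ E u v → E ℤ.+ ((u ℤ.- + 1) ℤ.* (u ℤ.- + 1) ℤ.- v ℤ.* v)
                                 ℤ.+ ((v ℤ.+ + 1) ℤ.* (v ℤ.+ + 1) ℤ.- u ℤ.* u)
                             ≡ E ℤ.- + 2 ℤ.* (u ℤ.- v ℤ.- + 1)
    swap-squares = solve-∀

  energy-decreasing : ∀ m g → Valid m → Enabled m g → energy (move m g) ℤ.< energy g
  energy-decreasing m g v en with i≤j⇒∃[n]j≡i+n en
  ... | n , gap≡ = subst (ℤ._< energy g) (sym energy≡) (i-j<i (energy g) 0<drop)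
    where
    drop = + 2 ℤ.* (+ p ℤ.* + (w ℕ.+ n))
    -- drop normalises to + suc _, as p and w are successors
    0<drop : + 0 ℤ.< drop
    0<drop = ℤ.+<+ (s≤s z≤n)
    energy≡ : energy (move m g) ≡ energy g ℤ.- drop
    energy≡ = begin
      energy (move m g)                                             ≡⟨ energy-move m g v ⟩
      energy g ℤ.- + 2 ℤ.* (+ p ℤ.* (g (upper m) ℤ.- g (lower m) ℤ.- t m))
        ≡⟨ cong (λ z → energy g ℤ.- + 2 ℤ.* (+ p ℤ.* (z ℤ.- t m))) gap≡ ⟩
      energy g ℤ.- + 2 ℤ.* (+ p ℤ.* (t m ℤ.+ + w ℤ.+ + n ℤ.- t m))
        ≡⟨ cong (λ z → energy g ℤ.- + 2 ℤ.* (+ p ℤ.* z)) (cancel (t m) (+ w) (+ n)) ⟩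
      energy g ℤ.- drop                                             ∎
      where cancel : ∀ T W N → T ℤ.+ W ℤ.+ N ℤ.- T ≡ W ℤ.+ N
            cancel = solve-∀

  μ : (ℕ → ℤ) → ℕ
  μ g = ℤ.∣ energy g ∣

  μ-decreasing : ∀ {g h} → g ⟶ h → μ h < μ g
  μ-decreasing {g} {h} (m , v , en , h≈) =
    subst (_< μ g) (cong ℤ.∣_∣ (Σℤ<-cong p (λ i i<p → cong (λ z → square (height i z)) (sym (h≈ i i<p)))))
      (0≤i<j⇒∣i∣<∣j∣ (Σℤ<-nonneg p _ (λ i → 0≤square (height i (move m g i)))) (energy-decreasing m g v en))

  ⟶-move : ∀ m {g} → Valid m → Enabled m g → g ⟶ move m g
  ⟶-move m v en = m , v , en , ≈-refl

  enabled? : ∀ m g → Dec (Enabled m g)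
  enabled? m g = + (shift m ℕ.+ w) ℤₚ.≤? g (upper m) ℤ.- g (lower m)

  Normal-intro : ∀ {g} → (∀ m → Valid m → ¬ Enabled m g) → Normal g
  Normal-intro stuck (m , v , en , _) = stuck m v en

  search-inner : ∀ g k → (∃ λ a → a < k × Enabled (inner a) g) ⊎ (∀ a → a < k → ¬ Enabled (inner a) g)
  search-inner g zero    = inj₂ λ _ ()
  search-inner g (suc k) with search-inner g k | enabled? (inner k) g
  ... | inj₁ (a , a<k , en) | _      = inj₁ (a , ℕₚ.m<n⇒m<1+n a<k , en)
  ... | inj₂ _              | yes en = inj₁ (k , ℕₚ.n<1+n k , en)
  ... | inj₂ none           | no ¬en = inj₂ λ a a<1+k → [ none a , (λ { refl → ¬en }) ]′ (ℕₚ.m<1+n⇒m<n∨m≡n a<1+k)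

  progress : ∀ g → ∃ (g ⟶_) ⊎ Normal g
  progress g with enabled? wrap g | search-inner g p′
  ... | yes en | _                    = inj₁ (_ , ⟶-move wrap tt en)
  ... | no _   | inj₁ (a , a<p′ , en) = inj₁ (_ , ⟶-move (inner a) (s≤s a<p′) en)
  ... | no ¬en | inj₂ none            = inj₂ (Normal-intro λ { (inner a) v → none a (ℕₚ.≤-pred v) ; wrap _ → ¬en })

  commute : ∀ m₁ m₂ {g} → Valid m₁ → Valid m₂ → Enabled m₁ g → Enabled m₂ g →
    upper m₁ ≢ upper m₂ → upper m₁ ≢ lower m₂ → lower m₁ ≢ upper m₂ → lower m₁ ≢ lower m₂ →
    Joinable (move m₁ g) (move m₂ g)
  commute m₁ m₂ {g} v₁ v₂ en₁ en₂ U≢U U≢L L≢U L≢L =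
    _ , _ , ⟶-move m₂ v₂ en₂′ ◅ ε , ⟶-move m₁ v₁ en₁′ ◅ ε , swapped
    where
    fixes₂ : ∀ {i} → i ≡ upper m₁ ⊎ i ≡ lower m₁ → move m₂ g i ≡ g i
    fixes₂ (inj₁ refl) = move-elsewhere m₂ g U≢U U≢L
    fixes₂ (inj₂ refl) = move-elsewhere m₂ g L≢U L≢L
    fixes₁ : ∀ {i} → i ≡ upper m₂ ⊎ i ≡ lower m₂ → move m₁ g i ≡ g i
    fixes₁ (inj₁ refl) = move-elsewhere m₁ g (U≢U ∘ sym) (L≢U ∘ sym)
    fixes₁ (inj₂ refl) = move-elsewhere m₁ g (U≢L ∘ sym) (L≢L ∘ sym)
    en₂′ : Enabled m₂ (move m₁ g)
    en₂′ = subst (+ (shift m₂ ℕ.+ w) ℤ.≤_) (sym (cong₂ ℤ._-_ (fixes₁ (inj₁ refl)) (fixes₁ (inj₂ refl)))) en₂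
    en₁′ : Enabled m₁ (move m₂ g)
    en₁′ = subst (+ (shift m₁ ℕ.+ w) ℤ.≤_) (sym (cong₂ ℤ._-_ (fixes₂ (inj₁ refl)) (fixes₂ (inj₂ refl)))) en₁
    swapped : move m₂ (move m₁ g) ≈ move m₁ (move m₂ g)
    swapped i _ with toSum (i ℕ.≟ upper m₁) | toSum (i ℕ.≟ lower m₁)
                   | toSum (i ℕ.≟ upper m₂) | toSum (i ℕ.≟ lower m₂)
    ... | inj₁ refl | _ | _ | _ = begin
      move m₂ (move m₁ g) (upper m₁)  ≡⟨ move-elsewhere m₂ (move m₁ g) U≢U U≢L ⟩
      move m₁ g (upper m₁)            ≡⟨ move-at-upper m₁ g refl ⟩
      g (lower m₁) ℤ.+ t m₁           ≡⟨ cong (ℤ._+ t m₁) (sym (fixes₂ (inj₂ refl))) ⟩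
      move m₂ g (lower m₁) ℤ.+ t m₁   ≡⟨ sym (move-at-upper m₁ (move m₂ g) refl) ⟩
      move m₁ (move m₂ g) (upper m₁)  ∎
    ... | inj₂ _ | inj₁ refl | _ | _ = begin
      move m₂ (move m₁ g) (lower m₁)  ≡⟨ move-elsewhere m₂ (move m₁ g) L≢U L≢L ⟩
      move m₁ g (lower m₁)            ≡⟨ move-at-lower m₁ g refl ⟩
      g (upper m₁) ℤ.- t m₁           ≡⟨ cong (ℤ._- t m₁) (sym (fixes₂ (inj₁ refl))) ⟩
      move m₂ g (upper m₁) ℤ.- t m₁   ≡⟨ sym (move-at-lower m₁ (move m₂ g) refl) ⟩
      move m₁ (move m₂ g) (lower m₁)  ∎
    ... | inj₂ i≢U₁ | inj₂ i≢L₁ | inj₁ refl | _ = begin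
      move m₂ (move m₁ g) (upper m₂)  ≡⟨ move-at-upper m₂ (move m₁ g) refl ⟩
      move m₁ g (lower m₂) ℤ.+ t m₂   ≡⟨ cong (ℤ._+ t m₂) (fixes₁ (inj₂ refl)) ⟩
      g (lower m₂) ℤ.+ t m₂           ≡⟨ sym (move-at-upper m₂ g refl) ⟩
      move m₂ g (upper m₂)            ≡⟨ sym (move-elsewhere m₁ (move m₂ g) i≢U₁ i≢L₁) ⟩
      move m₁ (move m₂ g) (upper m₂)  ∎
    ... | inj₂ i≢U₁ | inj₂ i≢L₁ | inj₂ _ | inj₁ refl = begin
      move m₂ (move m₁ g) (lower m₂)  ≡⟨ move-at-lower m₂ (move m₁ g) refl ⟩
      move m₁ g (upper m₂) ℤ.- t m₂   ≡⟨ cong (ℤ._- t m₂) (fixes₁ (inj₁ refl)) ⟩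
      g (upper m₂) ℤ.- t m₂           ≡⟨ sym (move-at-lower m₂ g refl) ⟩
      move m₂ g (lower m₂)            ≡⟨ sym (move-elsewhere m₁ (move m₂ g) i≢U₁ i≢L₁) ⟩
      move m₁ (move m₂ g) (lower m₂)  ∎
    ... | inj₂ i≢U₁ | inj₂ i≢L₁ | inj₂ i≢U₂ | inj₂ i≢L₂ = begin
      move m₂ (move m₁ g) i  ≡⟨ move-elsewhere m₂ (move m₁ g) i≢U₂ i≢L₂ ⟩
      move m₁ g i            ≡⟨ move-elsewhere m₁ g i≢U₁ i≢L₁ ⟩
      g i                    ≡⟨ sym (move-elsewhere m₂ g i≢U₂ i≢L₂) ⟩
      move m₂ g i            ≡⟨ sym (move-elsewhere m₁ (move m₂ g) i≢U₁ i≢L₁) ⟩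
      move m₁ (move m₂ g) i  ∎

  braid : ∀ m₁ m₂ {g} → Valid m₁ → Valid m₂ → upper m₁ ≡ lower m₂ → lower m₁ ≢ upper m₂ →
    Enabled m₁ g → Enabled m₂ g → Joinable (move m₁ g) (move m₂ g)
  braid m₁ m₂ {g} v₁ v₂ S≡L₂ X≢Y en₁ en₂ =
    move m₁ g₂ , move m₂ k₂ ,
    ⟶-move m₂ v₂ (enabled₂ g₁ (cong₂ ℤ._-_ g₁Y g₁S) gap₁) ◅
      ⟶-move m₁ v₁ (enabled₁ g₂ (cong₂ ℤ._-_ g₂S g₂X) gap₂) ◅ ε ,
    ⟶-move m₁ v₁ (enabled₁ k₁ (cong₂ ℤ._-_ k₁S k₁X) gap₃) ◅
      ⟶-move m₂ v₂ (enabled₂ k₂ (cong₂ ℤ._-_ k₂Y k₂S) gap₄) ◅ ε ,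
    agree
    where
    S = upper m₁
    X = lower m₁
    Y = upper m₂
    t₁ = t m₁
    t₂ = t m₂
    X≢S : X ≢ S
    X≢S = lower≢upper m₁
    S≢Y : S ≢ Y
    S≢Y S≡Y = lower≢upper m₂ (trans (sym S≡L₂) S≡Y)
    X≢L₂ : X ≢ lower m₂
    X≢L₂ X≡L₂ = X≢S (trans X≡L₂ (sym S≡L₂))
    at-L₂ : ∀ h → h (lower m₂) ≡ h S
    at-L₂ h = cong h (sym S≡L₂)
    enabled₁ : ∀ h {d} → h S ℤ.- h X ≡ d → + (shift m₁ ℕ.+ w) ℤ.≤ d → Enabled m₁ h
    enabled₁ h hS-hX≡d = subst (+ (shift m₁ ℕ.+ w) ℤ.≤_) (sym hS-hX≡d)
    enabled₂ : ∀ h {d} → h Y ℤ.- h S ≡ d → + (shift m₂ ℕ.+ w) ℤ.≤ d → Enabled m₂ h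
    enabled₂ h hY-hS≡d = subst (+ (shift m₂ ℕ.+ w) ℤ.≤_) (sym (trans (cong (λ z → h Y ℤ.- z) (at-L₂ h)) hY-hS≡d))
    gaps = braid-gaps (g X) (g S) (g Y) en₁ (subst (+ (shift m₂ ℕ.+ w) ℤ.≤_) (cong (λ z → g Y ℤ.- z) (at-L₂ g)) en₂)
    gap₁ = proj₁ gaps
    gap₂ = proj₁ (proj₂ gaps)
    gap₃ = proj₁ (proj₂ (proj₂ gaps))
    gap₄ = proj₂ (proj₂ (proj₂ gaps))
    g₁ = move m₁ g
    g₂ = move m₂ g₁
    k₁ = move m₂ g
    k₂ = move m₁ k₁
    g₁S : g₁ S ≡ g X ℤ.+ t₁
    g₁S = move-at-upper m₁ g refl
    g₁X : g₁ X ≡ g S ℤ.- t₁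
    g₁X = move-at-lower m₁ g refl
    g₁Y : g₁ Y ≡ g Y
    g₁Y = move-elsewhere m₁ g (S≢Y ∘ sym) (X≢Y ∘ sym)
    g₂S : g₂ S ≡ g Y ℤ.- t₂
    g₂S = trans (move-at-lower m₂ g₁ (sym S≡L₂)) (cong (ℤ._- t₂) g₁Y)
    g₂X : g₂ X ≡ g S ℤ.- t₁
    g₂X = trans (move-elsewhere m₂ g₁ X≢Y X≢L₂) g₁X
    g₂Y : g₂ Y ≡ g X ℤ.+ t₁ ℤ.+ t₂
    g₂Y = trans (move-at-upper m₂ g₁ refl) (cong (ℤ._+ t₂) (trans (at-L₂ g₁) g₁S))
    k₁S : k₁ S ≡ g Y ℤ.- t₂
    k₁S = move-at-lower m₂ g (sym S≡L₂)
    k₁X : k₁ X ≡ g X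
    k₁X = move-elsewhere m₂ g X≢Y X≢L₂
    k₁Y : k₁ Y ≡ g S ℤ.+ t₂
    k₁Y = trans (move-at-upper m₂ g refl) (cong (ℤ._+ t₂) (at-L₂ g))
    k₂S : k₂ S ≡ g X ℤ.+ t₁
    k₂S = trans (move-at-upper m₁ k₁ refl) (cong (ℤ._+ t₁) k₁X)
    k₂X : k₂ X ≡ g Y ℤ.- t₂ ℤ.- t₁
    k₂X = trans (move-at-lower m₁ k₁ refl) (cong (ℤ._- t₁) k₁S)
    k₂Y : k₂ Y ≡ g S ℤ.+ t₂
    k₂Y = trans (move-elsewhere m₁ k₁ (S≢Y ∘ sym) (X≢Y ∘ sym)) k₁Y
    agree : move m₁ g₂ ≈ move m₂ k₂
    agree i _ with toSum (i ℕ.≟ S) | toSum (i ℕ.≟ X) | toSum (i ℕ.≟ Y)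
    ... | inj₁ refl | _ | _ = begin
      move m₁ g₂ S              ≡⟨ trans (move-at-upper m₁ g₂ refl) (cong (ℤ._+ t₁) g₂X) ⟩
      g S ℤ.- t₁ ℤ.+ t₁         ≡⟨ shuffle (g S) t₁ t₂ ⟩
      g S ℤ.+ t₂ ℤ.- t₂         ≡⟨ sym (trans (move-at-lower m₂ k₂ (sym S≡L₂)) (cong (ℤ._- t₂) k₂Y)) ⟩
      move m₂ k₂ S              ∎
      where shuffle : ∀ s t₁ t₂ → s ℤ.- t₁ ℤ.+ t₁ ≡ s ℤ.+ t₂ ℤ.- t₂
            shuffle = solve-∀
    ... | inj₂ _ | inj₁ refl | _ = begin
      move m₁ g₂ X              ≡⟨ trans (move-at-lower m₁ g₂ refl) (cong (ℤ._- t₁) g₂S) ⟩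
      g Y ℤ.- t₂ ℤ.- t₁         ≡⟨ sym (trans (move-elsewhere m₂ k₂ X≢Y X≢L₂) k₂X) ⟩
      move m₂ k₂ X              ∎
    ... | inj₂ i≢S | inj₂ i≢X | inj₁ refl = begin
      move m₁ g₂ Y              ≡⟨ trans (move-elsewhere m₁ g₂ i≢S i≢X) g₂Y ⟩
      g X ℤ.+ t₁ ℤ.+ t₂
        ≡⟨ sym (trans (move-at-upper m₂ k₂ refl) (cong (ℤ._+ t₂) (trans (at-L₂ k₂) k₂S))) ⟩
      move m₂ k₂ Y              ∎
    ... | inj₂ i≢S | inj₂ i≢X | inj₂ i≢Y = begin
      move m₁ g₂ i  ≡⟨ move-elsewhere m₁ g₂ i≢S i≢X ⟩
      g₂ i          ≡⟨ move-elsewhere m₂ g₁ i≢Y i≢L₂ ⟩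
      g₁ i          ≡⟨ move-elsewhere m₁ g i≢S i≢X ⟩
      g i           ≡⟨ sym (move-elsewhere m₂ g i≢Y i≢L₂) ⟩
      k₁ i          ≡⟨ sym (move-elsewhere m₁ k₁ i≢S i≢X) ⟩
      k₂ i          ≡⟨ sym (move-elsewhere m₂ k₂ i≢Y i≢L₂) ⟩
      move m₂ k₂ i  ∎
      where i≢L₂ : i ≢ lower m₂
            i≢L₂ i≡L₂ = i≢S (trans i≡L₂ (sym S≡L₂))

  opposite : ∀ m₁ m₂ {g} → upper m₁ ≡ lower m₂ → lower m₁ ≡ upper m₂ → Enabled m₁ g → ¬ Enabled m₂ g
  opposite m₁ m₂ {g} U₁≡L₂ L₁≡U₂ en₁ en₂ =
    opposite-gaps (g (lower m₁)) (g (upper m₁)) en₁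
      (subst (+ (shift m₂ ℕ.+ w) ℤ.≤_) (cong₂ (λ i j → g i ℤ.- g j) (sym L₁≡U₂) (sym U₁≡L₂)) en₂)

  confluent : ∀ m₁ m₂ {g} → Valid m₁ → Valid m₂ → Enabled m₁ g → Enabled m₂ g →
    Joinable (move m₁ g) (move m₂ g)
  confluent (inner a) (inner b) v₁ v₂ en₁ en₂
    with toSum (a ℕ.≟ b) | toSum (suc a ℕ.≟ b) | toSum (suc b ℕ.≟ a)
  ... | inj₁ refl | _         | _         = _ , _ , ε , ε , ≈-refl
  ... | inj₂ _    | inj₁ refl | _         =
    braid (inner a) (inner b) v₁ v₂ refl (ℕₚ.<⇒≢ (ℕₚ.m<n⇒m<1+n (ℕₚ.n<1+n a))) en₁ en₂
  ... | inj₂ _    | inj₂ _    | inj₁ refl =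
    Joinable-sym (braid (inner b) (inner a) v₂ v₁ refl (ℕₚ.<⇒≢ (ℕₚ.m<n⇒m<1+n (ℕₚ.n<1+n b))) en₂ en₁)
  ... | inj₂ a≢b  | inj₂ 1+a≢b | inj₂ 1+b≢a =
    commute (inner a) (inner b) v₁ v₂ en₁ en₂ (a≢b ∘ ℕₚ.suc-injective) 1+a≢b (1+b≢a ∘ sym) a≢b
  confluent (inner a) wrap {g} v₁ _ en₁ en₂ with toSum (a ℕ.≟ 0) | toSum (suc a ℕ.≟ p′)
  ... | inj₁ refl | inj₁ 1≡p′  = contradiction en₂ (opposite (inner 0) wrap {g} 1≡p′ refl en₁)
  ... | inj₁ refl | inj₂ 1≢p′  = Joinable-sym (braid wrap (inner 0) tt v₁ refl (1≢p′ ∘ sym) en₂ en₁)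
  ... | inj₂ a≢0  | inj₁ 1+a≡p′ = braid (inner a) wrap v₁ tt 1+a≡p′ a≢0 en₁ en₂
  ... | inj₂ a≢0  | inj₂ 1+a≢p′ =
    commute (inner a) wrap v₁ tt en₁ en₂ (λ ()) 1+a≢p′ a≢0 (ℕₚ.<⇒≢ (ℕₚ.≤-pred v₁))
  confluent wrap (inner a) v₁ v₂ en₁ en₂ = Joinable-sym (confluent (inner a) wrap v₂ v₁ en₂ en₁)
  confluent wrap wrap      _  _  _   _   = _ , _ , ε , ε , ≈-refl

  locally-confluent : ∀ {g h₁ h₂} → g ⟶ h₁ → g ⟶ h₂ → Joinable h₁ h₂
  locally-confluent (m₁ , v₁ , en₁ , h₁≈) (m₂ , v₂ , en₂ , h₂≈) =
    Joinable-resp ⟶-respˡ (≈-sym h₁≈) (≈-sym h₂≈) (confluent m₁ m₂ v₁ v₂ en₁ en₂)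

  normal-form : ∀ g → ∃ (g ⇓_)
  normal-form = normalise ⟶-respˡ μ μ-decreasing progress locally-confluent

  normal-form-unique : ∀ {g n n′} → g ⇓ n → g ⇓ n′ → n ≈ n′
  normal-form-unique = ⇓-unique ⟶-respˡ μ μ-decreasing progress locally-confluent

  ≗ᵥ⇒≈ : ∀ {c d : Vecℤ p} → c ≗ᵥ d → get c ≈ get d
  ≗ᵥ⇒≈ {c} {d} c≗d i i<p = trans (get-lookup c i<p) (trans (c≗d _) (sym (get-lookup d i<p)))

  ≈⇒≗ᵥ : ∀ {c d : Vecℤ p} → get c ≈ get d → c ≗ᵥ d
  ≈⇒≗ᵥ {c} {d} c≈d i = trans (sym (get-toℕ c i)) (trans (c≈d _ (Finₚ.toℕ<n i)) (get-toℕ d i))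

  apply : Move → Vecℤ p → Vecℤ p
  apply (inner a) c = scJ p c (suc a)
  apply wrap      c = sc0 p c

  get-apply : ∀ m c → get (apply m c) ≈ move m (get c)
  get-apply (inner a) c = get-tabulate _ _ λ i →
    cong₂ (λ u z → if ⌊ toℕ i ℕ.≟ suc a ⌋ then u else z) (sym (ℤₚ.+-identityʳ _))
      (cong₂ (λ u z → if ⌊ toℕ i ℕ.≟ a ⌋ then u else z) (sym (ℤₚ.+-identityʳ _)) (sym (get-toℕ c i)))
  get-apply wrap      c = get-tabulate _ _ λ i →
    cong (λ z → if ⌊ toℕ i ℕ.≟ 0 ⌋ then get c p′ ℤ.+ + 1 else (if ⌊ toℕ i ℕ.≟ p′ ⌋ then get c 0 ℤ.- + 1 else z))
         (sym (get-toℕ c i))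

  step⇒⟶ : ∀ {c d} → ScStep p w c d → get c ⟶ get d
  step⇒⟶ {c} (stepJ (suc a) _ v allowed d≗) =
    inner a , v , allowed , ≈-trans (≗ᵥ⇒≈ d≗) (get-apply (inner a) c)
  step⇒⟶ {c} (step0 allowed d≗) =
    wrap , tt , ℤₚ.i<j⇒suc[i]≤j allowed , ≈-trans (≗ᵥ⇒≈ d≗) (get-apply wrap c)

  ⟶⇒step : ∀ {c h} → get c ⟶ h → ∃ λ d → ScStep p w c d × get d ≈ h
  ⟶⇒step {c} (inner a , v , en , h≈) =
    apply (inner a) c , stepJ (suc a) (s≤s z≤n) v en (λ _ → refl) , ≈-trans (get-apply (inner a) c) (≈-sym h≈)
  ⟶⇒step {c} (wrap , _ , en , h≈) =
    apply wrap c , step0 (ℤₚ.suc[i]≤j⇒i<j en) (λ _ → refl) , ≈-trans (get-apply wrap c) (≈-sym h≈)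

  Ancestor⇒Normal : ∀ {c} → Ancestor p w c → Normal (get c)
  Ancestor⇒Normal anc (inner a , v , en , _) = anc (inj₁ (suc a , s≤s z≤n , v , en))
  Ancestor⇒Normal anc (wrap , _ , en , _)    = anc (inj₂ (ℤₚ.suc[i]≤j⇒i<j en))

  Normal⇒Ancestor : ∀ {c} → Normal (get c) → Ancestor p w c
  Normal⇒Ancestor nc (inj₁ (suc a , _ , v , allowed)) = nc (⟶-move (inner a) v allowed)
  Normal⇒Ancestor nc (inj₂ allowed)                    = nc (⟶-move wrap tt (ℤₚ.i<j⇒suc[i]≤j allowed))

  ScopesEq-Σ : ∀ {c d} → ScopesEq p w c d → Σℤ< p (get c) ≡ Σℤ< p (get d)
  ScopesEq-Σ (eq-refl c≗d)   = Σℤ<-cong p (≗ᵥ⇒≈ c≗d)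
  ScopesEq-Σ (eq-step s) with step⇒⟶ s
  ... | m , v , _ , d≈ = sym (trans (Σℤ<-cong p d≈) (Σ-move m _ v))
  ScopesEq-Σ (eq-sym q)      = sym (ScopesEq-Σ q)
  ScopesEq-Σ (eq-trans q q′) = trans (ScopesEq-Σ q) (ScopesEq-Σ q′)

  ⟶*⇒ScopesEq : ∀ {c g h} → get c ≈ g → g ⟶* h → ∃ λ d → ScopesEq p w c d × get d ≈ h
  ⟶*⇒ScopesEq c≈g ε = _ , eq-refl (λ _ → refl) , c≈g
  ⟶*⇒ScopesEq c≈g (g⟶g′ ◅ g′⟶*h) with ⟶⇒step (⟶-respˡ (≈-sym c≈g) g⟶g′)
  ... | d , c⇒d , d≈g′ with ⟶*⇒ScopesEq d≈g′ g′⟶*h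
  ...   | e , d~e , e≈h = e , eq-trans (eq-step c⇒d) d~e , e≈h

  ancestor-in-family : ∀ c → ∃ λ d → ScopesEq p w c d × Ancestor p w d
  ancestor-in-family c with normal-form (get c)
  ... | _ , e , c⟶*e , ne , _ with ⟶*⇒ScopesEq ≈-refl c⟶*e
  ...   | d , c~d , d≈e = d , c~d , Normal⇒Ancestor (Normal-resp ⟶-respˡ (≈-sym d≈e) ne)

  ScopesEq⇒same-normal-form : ∀ {c d n n′} → ScopesEq p w c d → get c ⇓ n → get d ⇓ n′ → n ≈ n′
  ScopesEq⇒same-normal-form (eq-refl c≗d) c⇓n d⇓n′ =
    normal-form-unique c⇓n (⇓-respˡ ⟶-respˡ (≈-sym (≗ᵥ⇒≈ c≗d)) d⇓n′)
  ScopesEq⇒same-normal-form (eq-step s) c⇓n d⇓n′ = normal-form-unique c⇓n (⟶*-⇓ (step⇒⟶ s ◅ ε) d⇓n′)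
  ScopesEq⇒same-normal-form (eq-sym q) c⇓n d⇓n′ = ≈-sym (ScopesEq⇒same-normal-form q d⇓n′ c⇓n)
  ScopesEq⇒same-normal-form (eq-trans {d = e} q q′) c⇓n d⇓n′ with normal-form (get e)
  ... | _ , e⇓m = ≈-trans (ScopesEq⇒same-normal-form q c⇓n e⇓m) (ScopesEq⇒same-normal-form q′ e⇓m d⇓n′)

  ScopesEq-ancestors⇒≗ᵥ : ∀ {c d} → Ancestor p w c → Ancestor p w d → ScopesEq p w c d → c ≗ᵥ d
  ScopesEq-ancestors⇒≗ᵥ anc-c anc-d c~d = ≈⇒≗ᵥ
    (ScopesEq⇒same-normal-form c~d (Normal⇒⇓ (Ancestor⇒Normal anc-c)) (Normal⇒⇓ (Ancestor⇒Normal anc-d)))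

module Profile (p′ w′ : ℕ) where

  p w : ℕ
  p = suc p′
  w = suc w′

  -- c_{k,j} of the paper with c_{k,0} replaced by an arbitrary C; k_{i+1} is stored as K i.
  profile : ℤ → (ℕ → ℕ) → ℕ → ℤ
  profile C K j = C ℤ.+ + (j ℕ.* w′) ℤ.- + Σℕ< j K

  weighted : (ℕ → ℕ) → ℕ
  weighted K = Σℕ< p (λ i → suc i ℕ.* K i)

  pw∸[p∸1]≡1+pw′ : p ℕ.* w ℕ.∸ (p ℕ.∸ 1) ≡ suc (p ℕ.* w′)
  pw∸[p∸1]≡1+pw′ = trans (cong (ℕ._∸ p′) (expand p′ w′)) (ℕₚ.m+n∸n≡m (suc (p ℕ.* w′)) p′)
    where expand : ∀ p′ w′ → suc p′ ℕ.* suc w′ ≡ suc (suc p′ ℕ.* w′) ℕ.+ p′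
          expand = ℕ-Ring.solve-∀

  Xval≡ : Xval p w ≡ w′ ℕ.* (Σℕ< p (λ j → j) ℕ.+ p)
  Xval≡ = trans (cong (ℕ._/ 2) twice) (ℕ.m*n/n≡m (w′ ℕ.* (T ℕ.+ p)) 2)
    where
    T = Σℕ< p (λ j → j)
    twice : w′ ℕ.* p ℕ.* (p ℕ.+ 1) ≡ w′ ℕ.* (T ℕ.+ p) ℕ.* 2
    twice = begin
      w′ ℕ.* p ℕ.* (p ℕ.+ 1)               ≡⟨ expand w′ p ⟩
      w′ ℕ.* (p ℕ.* p ℕ.+ p)               ≡⟨ cong (λ z → w′ ℕ.* (z ℕ.+ p)) (sym (2*Σℕ<id+n≡n*n p)) ⟩
      w′ ℕ.* (2 ℕ.* T ℕ.+ p ℕ.+ p)         ≡⟨ regroup w′ T p ⟩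
      w′ ℕ.* (T ℕ.+ p) ℕ.* 2               ∎
      where expand : ∀ w′ p → w′ ℕ.* p ℕ.* (p ℕ.+ 1) ≡ w′ ℕ.* (p ℕ.* p ℕ.+ p)
            expand = ℕ-Ring.solve-∀
            regroup : ∀ w′ T p → w′ ℕ.* (2 ℕ.* T ℕ.+ p ℕ.+ p) ≡ w′ ℕ.* (T ℕ.+ p) ℕ.* 2
            regroup = ℕ-Ring.solve-∀

  Σj*w′+Xval+p≡ : Σℕ< p (λ j → j ℕ.* w′) ℕ.+ Xval p w ℕ.+ p ≡ p ℕ.* suc (p ℕ.* w′)
  Σj*w′+Xval+p≡ = begin
    Σℕ< p (λ j → j ℕ.* w′) ℕ.+ Xval p w ℕ.+ p
      ≡⟨ cong₂ (λ a x → a ℕ.+ x ℕ.+ p) (Σℕ<-distribʳ-* p (λ j → j) w′) Xval≡ ⟩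
    T ℕ.* w′ ℕ.+ w′ ℕ.* (T ℕ.+ p) ℕ.+ p          ≡⟨ regroup T w′ p ⟩
    w′ ℕ.* (2 ℕ.* T ℕ.+ p) ℕ.+ p                 ≡⟨ cong (λ z → w′ ℕ.* z ℕ.+ p) (2*Σℕ<id+n≡n*n p) ⟩
    w′ ℕ.* (p ℕ.* p) ℕ.+ p                       ≡⟨ factor w′ p ⟩
    p ℕ.* suc (p ℕ.* w′)                         ∎
    where
    T = Σℕ< p (λ j → j)
    regroup : ∀ T w′ p → T ℕ.* w′ ℕ.+ w′ ℕ.* (T ℕ.+ p) ℕ.+ p ≡ w′ ℕ.* (2 ℕ.* T ℕ.+ p) ℕ.+ p
    regroup = ℕ-Ring.solve-∀
    factor : ∀ w′ p → w′ ℕ.* (p ℕ.* p) ℕ.+ p ≡ p ℕ.* suc (p ℕ.* w′)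
    factor = ℕ-Ring.solve-∀

  profile-sum : ∀ C K → Σℕ< p K ≡ suc (p ℕ.* w′) →
    Σℤ< p (profile C K) ≡ + p ℤ.* (C ℤ.- + 1) ℤ.- (+ Xval p w ℤ.- + weighted K)
  profile-sum C K total = begin
    Σℤ< p (profile C K)
      ≡⟨ Σℤ<-affine p C (λ j → + (j ℕ.* w′)) (λ j → + Σℕ< j K) ⟩
    + p ℤ.* C ℤ.+ Σℤ< p (λ j → + (j ℕ.* w′)) ℤ.- Σℤ< p (λ j → + Σℕ< j K)
      ≡⟨ cong₂ (λ a b → + p ℤ.* C ℤ.+ a ℤ.- b)
               (sym (Σℕ<-cast p (λ j → j ℕ.* w′))) (sym (Σℕ<-cast p (λ j → Σℕ< j K))) ⟩
    + p ℤ.* C ℤ.+ + A ℤ.- + B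
      ≡⟨ balanced (+ p) C (+ A) (+ Xval p w) (+ B) (+ weighted K) (begin
           + A ℤ.+ + Xval p w ℤ.+ + p     ≡⟨ cong +_ (trans Σj*w′+Xval+p≡ (sym B+W≡)) ⟩
           + (B ℕ.+ weighted K)           ∎) ⟩
    + p ℤ.* (C ℤ.- + 1) ℤ.- (+ Xval p w ℤ.- + weighted K) ∎
    where
    A = Σℕ< p (λ j → j ℕ.* w′)
    B = Σℕ< p (λ j → Σℕ< j K)
    B+W≡ : B ℕ.+ weighted K ≡ p ℕ.* suc (p ℕ.* w′)
    B+W≡ = trans (Σℕ<-summation-by-parts p K) (cong (p ℕ.*_) total)
    balanced : ∀ P C A X B W → A ℤ.+ X ℤ.+ P ≡ B ℤ.+ W →
               P ℤ.* C ℤ.+ A ℤ.- B ≡ P ℤ.* (C ℤ.- + 1) ℤ.- (X ℤ.- W)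
    balanced P C A X B W eq = begin
      P ℤ.* C ℤ.+ A ℤ.- B                       ≡⟨ split P C A X B W ⟩
      R ℤ.+ ((A ℤ.+ X ℤ.+ P) ℤ.- (B ℤ.+ W))     ≡⟨ cong (λ z → R ℤ.+ (z ℤ.- (B ℤ.+ W))) eq ⟩
      R ℤ.+ ((B ℤ.+ W) ℤ.- (B ℤ.+ W))           ≡⟨ cancel R (B ℤ.+ W) ⟩
      R                                         ∎
      where R = P ℤ.* (C ℤ.- + 1) ℤ.- (X ℤ.- W)
            split : ∀ P C A X B W → P ℤ.* C ℤ.+ A ℤ.- B
                                    ≡ P ℤ.* (C ℤ.- + 1) ℤ.- (X ℤ.- W) ℤ.+ ((A ℤ.+ X ℤ.+ P) ℤ.- (B ℤ.+ W))
            split = solve-∀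
            cancel : ∀ x y → x ℤ.+ (y ℤ.- y) ≡ x
            cancel = solve-∀

  profile-sum≡0⇔ : ∀ C K → Σℕ< p K ≡ suc (p ℕ.* w′) →
    Σℤ< p (profile C K) ≡ + 0 ⇔ + Xval p w ℤ.- + weighted K ≡ (C ℤ.- + 1) ℤ.* + p
  profile-sum≡0⇔ C K total = mk⇔
    (λ Σ≡0 → begin
      D                    ≡⟨ D≡E-[E-D] E D ⟩
      E ℤ.- (E ℤ.- D)      ≡⟨ cong (λ z → E ℤ.- z) (trans (sym (profile-sum C K total)) Σ≡0) ⟩
      E ℤ.- + 0            ≡⟨ E-0≡[C-1]*p (+ p) (C ℤ.- + 1) ⟩
      (C ℤ.- + 1) ℤ.* + p  ∎)
    (λ D≡ → begin
      Σℤ< p (profile C K)            ≡⟨ profile-sum C K total ⟩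
      E ℤ.- D                        ≡⟨ cong (λ z → E ℤ.- z) D≡ ⟩
      E ℤ.- (C ℤ.- + 1) ℤ.* + p      ≡⟨ E-[C-1]*p≡0 (+ p) (C ℤ.- + 1) ⟩
      + 0                            ∎)
    where
    D = + Xval p w ℤ.- + weighted K
    E = + p ℤ.* (C ℤ.- + 1)
    D≡E-[E-D] : ∀ E D → D ≡ E ℤ.- (E ℤ.- D)
    D≡E-[E-D] = solve-∀
    E-0≡[C-1]*p : ∀ P C → P ℤ.* C ℤ.- + 0 ≡ C ℤ.* P
    E-0≡[C-1]*p = solve-∀
    E-[C-1]*p≡0 : ∀ P C → P ℤ.* C ℤ.- C ℤ.* P ≡ + 0
    E-[C-1]*p≡0 = solve-∀

  profile-step : ∀ C K a → profile C K (suc a) ℤ.- profile C K a ≡ + w′ ℤ.- + K a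
  profile-step C K a = difference C (+ w′) (+ (a ℕ.* w′)) (+ Σℕ< a K) (+ K a)
    where difference : ∀ C W A S k → C ℤ.+ (W ℤ.+ A) ℤ.- (S ℤ.+ k) ℤ.- (C ℤ.+ A ℤ.- S) ≡ W ℤ.- k
          difference = solve-∀

  profile-wrap : ∀ C K → Σℕ< p K ≡ suc (p ℕ.* w′) → profile C K 0 ℤ.- profile C K p′ ≡ + w ℤ.- + K p′
  profile-wrap C K total = begin
    C ℤ.+ + 0 ℤ.- + 0 ℤ.- (C ℤ.+ + (p′ ℕ.* w′) ℤ.- + Σℕ< p′ K)
      ≡⟨ cong (λ z → C ℤ.+ + 0 ℤ.- + 0 ℤ.- (C ℤ.+ + (p′ ℕ.* w′) ℤ.- z)) (m+n≡o⇒+m≡+o-+n total) ⟩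
    C ℤ.+ + 0 ℤ.- + 0 ℤ.- (C ℤ.+ + (p′ ℕ.* w′) ℤ.- (+ 1 ℤ.+ (+ w′ ℤ.+ + (p′ ℕ.* w′)) ℤ.- + K p′))
      ≡⟨ difference C (+ w′) (+ (p′ ℕ.* w′)) (+ K p′) ⟩
    + 1 ℤ.+ + w′ ℤ.- + K p′ ∎
    where difference : ∀ C W A k → C ℤ.+ + 0 ℤ.- + 0 ℤ.- (C ℤ.+ A ℤ.- (+ 1 ℤ.+ (W ℤ.+ A) ℤ.- k))
                                   ≡ + 1 ℤ.+ W ℤ.- k
          difference = solve-∀

  telescope : ∀ (g : ℕ → ℤ) K → (∀ a → suc a < p → g (suc a) ℤ.- g a ≡ + w′ ℤ.- + K a) →
    ∀ j → j < p → g j ≡ profile (g 0) K j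
  telescope g K steps zero    _     = x≡x+0-0 (g 0)
    where x≡x+0-0 : ∀ x → x ≡ x ℤ.+ + 0 ℤ.- + 0
          x≡x+0-0 = solve-∀
  telescope g K steps (suc a) 1+a<p = begin
    g (suc a)                          ≡⟨ y≡x+[y-x] (g a) (g (suc a)) ⟩
    g a ℤ.+ (g (suc a) ℤ.- g a)        ≡⟨ cong₂ ℤ._+_ (telescope g K steps a (ℕₚ.<-trans (ℕₚ.n<1+n a) 1+a<p))
                                                     (trans (steps a 1+a<p) (sym (profile-step (g 0) K a))) ⟩
    P a ℤ.+ (P (suc a) ℤ.- P a)        ≡⟨ sym (y≡x+[y-x] (P a) (P (suc a))) ⟩
    P (suc a)                          ∎
    where P = profile (g 0) K
          y≡x+[y-x] : ∀ x y → y ≡ x ℤ.+ (y ℤ.- x)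
          y≡x+[y-x] = solve-∀

  telescope-total : ∀ (g : ℕ → ℤ) K → (∀ j → j < p → g j ≡ profile (g 0) K j) →
    g 0 ℤ.- g p′ ≡ + w ℤ.- + K p′ → Σℕ< p K ≡ suc (p ℕ.* w′)
  telescope-total g K g≡profile wrap-gap = ℤₚ.+-injective (begin
    + Σℕ< p′ K ℤ.+ + K p′
      ≡⟨ rearrange (g 0) A (+ Σℕ< p′ K) (+ K p′) ⟩
    g 0 ℤ.- (g 0 ℤ.+ A ℤ.- + Σℕ< p′ K) ℤ.+ A ℤ.+ + K p′
      ≡⟨ cong (λ z → g 0 ℤ.- z ℤ.+ A ℤ.+ + K p′) (sym (g≡profile p′ (ℕₚ.n<1+n p′))) ⟩
    g 0 ℤ.- g p′ ℤ.+ A ℤ.+ + K p′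
      ≡⟨ cong (λ z → z ℤ.+ A ℤ.+ + K p′) wrap-gap ⟩
    + w ℤ.- + K p′ ℤ.+ A ℤ.+ + K p′
      ≡⟨ cancel (+ w) A (+ K p′) ⟩
    + w ℤ.+ A                                   ∎)
    where A = + (p′ ℕ.* w′)
          rearrange : ∀ g₀ A S k → S ℤ.+ k ≡ g₀ ℤ.- (g₀ ℤ.+ A ℤ.- S) ℤ.+ A ℤ.+ k
          rearrange = solve-∀
          cancel : ∀ W A k → W ℤ.- k ℤ.+ A ℤ.+ k ≡ W ℤ.+ A
          cancel = solve-∀

module Ancestors (p′ w′ : ℕ) (1≤p′ : 1 ≤ p′) (j0 : ℕ)
                 (j0≡X : j0 % suc p′ ≡ Xval (suc p′) (suc w′) % suc p′) where
  open Moves p′ w′ 1≤p′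
  open Profile p′ w′ hiding (p; w)

  profile-normal : ∀ C K → Σℕ< p K ≡ suc (p ℕ.* w′) → Normal (profile C K)
  profile-normal C K total = Normal-intro λ where
      (inner a) _ en → too-big {w′} {K a} (subst (+ w ℤ.≤_) (profile-step C K a) en)
      wrap      _ en → too-big {w} {K p′} (subst (+ suc w ℤ.≤_) (profile-wrap C K total) en)
    where too-big : ∀ {k m} → ¬ (+ suc k ℤ.≤ + k ℤ.- + m)
          too-big {k} {m} le = ℕₚ.n≮n k (ℤₚ.drop‿+≤+ (ℤₚ.≤-trans le (ℤₚ.i-j≤i (+ k) (+ m))))

  -- The deficit at a is k_{a+1}: how far the move with lower position a is from being allowed.
  deficit : (ℕ → ℤ) → ℕ → ℤ
  deficit g a with suc a <? p
  ... | yes _ = + w′ ℤ.- (g (suc a) ℤ.- g a)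
  ... | no _  = + w ℤ.- (g 0 ℤ.- g p′)

  deficit-inner : ∀ g {a} → suc a < p → deficit g a ≡ + w′ ℤ.- (g (suc a) ℤ.- g a)
  deficit-inner g {a} v with suc a <? p
  ... | yes _ = refl
  ... | no ¬v = contradiction v ¬v

  deficit-last : ∀ g → deficit g p′ ≡ + w ℤ.- (g 0 ℤ.- g p′)
  deficit-last g with suc p′ <? p
  ... | yes v = contradiction v (ℕₚ.n≮n p)
  ... | no _  = refl

  0≤deficit : ∀ {g} → Normal g → ∀ a → + 0 ℤ.≤ deficit g a
  0≤deficit ng a with suc a <? p
  ... | yes v = k+1≰d⇒0≤k-d λ en → ng (⟶-move (inner a) v en)
  ... | no _  = k+1≰d⇒0≤k-d λ en → ng (⟶-move wrap tt en)

  deficits : (ℕ → ℤ) → Fin p → ℕ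
  deficits g i = ℤ.∣ deficit g (toℕ i) ∣

  +deficits : ∀ {g} → Normal g → ∀ {a} → a < p → + getℕ (deficits g) a ≡ deficit g a
  +deficits {g} ng {a} a<p = begin
    + getℕ (deficits g) a             ≡⟨ cong +_ (getℕ-lookup (deficits g) a<p) ⟩
    + ℤ.∣ deficit g (toℕ (fromℕ< a<p)) ∣ ≡⟨ cong (λ i → + ℤ.∣ deficit g i ∣) (Finₚ.toℕ-fromℕ< a<p) ⟩
    + ℤ.∣ deficit g a ∣                ≡⟨ ℤₚ.0≤i⇒+∣i∣≡i (0≤deficit ng a) ⟩
    deficit g a                       ∎

  k≡W-d⇒d≡W-k : ∀ {W d k} → + k ≡ W ℤ.- d → d ≡ W ℤ.- + k
  k≡W-d⇒d≡W-k {W} {d} k≡ = trans (d≡W-[W-d] W d) (cong (λ z → W ℤ.- z) (sym k≡))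
    where d≡W-[W-d] : ∀ W d → d ≡ W ℤ.- (W ℤ.- d)
          d≡W-[W-d] = solve-∀

  InE⇒ancestor : ∀ k {c} → InE p w j0 k → c ≗ᵥ ck p w k → InCp p c × Ancestor p w c
  InE⇒ancestor k {c} (total₀ , weighted≡j0) c≗ck =
    incp , Normal⇒Ancestor (Normal-resp ⟶-respˡ (≈-sym c≈) (profile-normal (ck0 p w k) K total))
    where
    K = getℕ k
    total : Σℕ< p K ≡ suc (p ℕ.* w′)
    total = trans total₀ pw∸[p∸1]≡1+pw′
    q = + (Xval p w ℕ./ p) ℤ.- + (weighted K ℕ./ p)
    X-W≡ : + Xval p w ℤ.- + weighted K ≡ q ℤ.* + p
    X-W≡ = m%d≡n%d⇒m-n≡[m/d-n/d]*d (Xval p w) (weighted K) p (sym (trans weighted≡j0 j0≡X))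
    ck0≡ : ck0 p w k ≡ q ℤ.+ + 1
    ck0≡ = cong (ℤ._+ + 1) (trans (cong (_/ℕ p) X-W≡) ([i*n]/ℕn≡i q p))
    c≈ : get c ≈ profile (ck0 p w k) K
    c≈ = get-tabulate c _ c≗ck
    q≡ck0-1 : q ≡ ck0 p w k ℤ.- + 1
    q≡ck0-1 = trans (x≡x+1-1 q) (cong (ℤ._- + 1) (sym ck0≡))
      where x≡x+1-1 : ∀ x → x ≡ x ℤ.+ + 1 ℤ.- + 1
            x≡x+1-1 = solve-∀
    incp : InCp p c
    incp = trans (Σℤ<-cong p c≈) (Equivalence.from (profile-sum≡0⇔ (ck0 p w k) K total)
             (trans X-W≡ (cong (ℤ._* + p) q≡ck0-1)))

  ancestor⇒InE : ∀ {c} → InCp p c → Ancestor p w c → Σ (Fin p → ℕ) λ k → InE p w j0 k × c ≗ᵥ ck p w k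
  ancestor⇒InE {c} incp anc = k , (trans total (sym pw∸[p∸1]≡1+pw′) , weighted≡j0) , c≗ck
    where
    g = get c
    ng = Ancestor⇒Normal anc
    k = deficits g
    K = getℕ k
    g≡profile : ∀ j → j < p → g j ≡ profile (g 0) K j
    g≡profile = telescope g K λ a v →
      k≡W-d⇒d≡W-k {W = + w′} (trans (+deficits ng (ℕₚ.<-trans (ℕₚ.n<1+n a) v)) (deficit-inner g v))
    total : Σℕ< p K ≡ suc (p ℕ.* w′)
    total = telescope-total g K g≡profile (k≡W-d⇒d≡W-k {W = + w} (trans (+deficits ng (ℕₚ.n<1+n p′)) (deficit-last g)))
    X-W≡ : + Xval p w ℤ.- + weighted K ≡ (g 0 ℤ.- + 1) ℤ.* + p
    X-W≡ = Equivalence.to (profile-sum≡0⇔ (g 0) K total) (trans (sym (Σℤ<-cong p g≡profile)) incp)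
    weighted≡j0 : weighted K % p ≡ j0 % p
    weighted≡j0 = trans (sym (m-n≡q*d⇒m%d≡n%d (Xval p w) (weighted K) p (g 0 ℤ.- + 1) X-W≡)) (sym j0≡X)
    ck0≡ : ck0 p w k ≡ g 0
    ck0≡ = begin
      (+ Xval p w ℤ.- + weighted K) /ℕ p ℤ.+ + 1  ≡⟨ cong (λ z → (z /ℕ p) ℤ.+ + 1) X-W≡ ⟩
      ((g 0 ℤ.- + 1) ℤ.* + p) /ℕ p ℤ.+ + 1      ≡⟨ cong (ℤ._+ + 1) ([i*n]/ℕn≡i (g 0 ℤ.- + 1) p) ⟩
      g 0 ℤ.- + 1 ℤ.+ + 1                        ≡⟨ x-1+1≡x (g 0) ⟩
      g 0                                        ∎
      where x-1+1≡x : ∀ x → x ℤ.- + 1 ℤ.+ + 1 ≡ x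
            x-1+1≡x = solve-∀
    c≗ck : c ≗ᵥ ck p w k
    c≗ck i = begin
      c i                          ≡⟨ sym (get-toℕ c i) ⟩
      g (toℕ i)                    ≡⟨ g≡profile (toℕ i) (Finₚ.toℕ<n i) ⟩
      profile (g 0) K (toℕ i)      ≡⟨ cong (λ C → profile C K (toℕ i)) (sym ck0≡) ⟩
      ck p w k i                   ∎

  ancestors⇔InE : (c : Vecℤ p) → (InCp p c × Ancestor p w c) ⇔ Σ (Fin p → ℕ) (λ k → InE p w j0 k × (c ≗ᵥ ck p w k))
  ancestors⇔InE c = mk⇔ (λ (incp , anc) → ancestor⇒InE incp anc) (λ (k , inE , c≗ck) → InE⇒ancestor k inE c≗ck)

  family-representative : (c : Vecℤ p) → InCp p c →
    Σ (Fin p → ℕ) (λ k → InE p w j0 k × ScopesEq p w c (ck p w k))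
  family-representative c incp =
    let d , c~d , anc-d = ancestor-in-family c
        k , inE , d≗ck  = ancestor⇒InE (trans (sym (ScopesEq-Σ c~d)) incp) anc-d
    in k , inE , eq-trans c~d (eq-refl d≗ck)

  representatives-distinct : (k k′ : Fin p → ℕ) → InE p w j0 k → InE p w j0 k′ →
    ScopesEq p w (ck p w k) (ck p w k′) → ck p w k ≗ᵥ ck p w k′
  representatives-distinct k k′ inE inE′ =
    ScopesEq-ancestors⇒≗ᵥ (proj₂ (InE⇒ancestor k inE λ _ → refl)) (proj₂ (InE⇒ancestor k′ inE′ λ _ → refl))

1<prime : ∀ {p} → Prime p → 1 < p
1<prime {p} (Data.Nat.Primality.prime _) = ℕ.nonTrivial⇒n>1 p

theorem4p10 : (p w j0 : ℕ) .{{_ : NonZero p}} → Prime p → 1 ≤ w →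
    j0 < p → j0 % p ≡ Xval p w % p →
    ((c : Vecℤ p) →
      (InCp p c × Ancestor p w c) ⇔ Σ (Fin p → ℕ) (λ k → InE p w j0 k × (c ≗ᵥ ck p w k)))
    × ((c : Vecℤ p) → InCp p c →
      Σ (Fin p → ℕ) (λ k → InE p w j0 k × ScopesEq p w c (ck p w k)))
    × ((k k′ : Fin p → ℕ) → InE p w j0 k → InE p w j0 k′ →
      ScopesEq p w (ck p w k) (ck p w k′) → ck p w k ≗ᵥ ck p w k′)
theorem4p10 (suc (suc n)) (suc w′) j0 _ _ _ j0≡X = ancestors⇔InE , family-representative , representatives-distinct
  where open Ancestors (suc n) w′ (s≤s z≤n) j0 j0≡X
theorem4p10 (suc zero) _ _ pr _ _ _ = contradiction (1<prime pr) (ℕₚ.n≮n 1)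
theorem4p10 (suc (suc _)) zero _ _ () _ _
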